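{- For positive integers $\alpha,\beta$: $(\alpha,\beta)\in\mathrm{HWP}(30;3,5)$ if and only if $\alpha+\beta=14$.
   Context: A $C_k$-factor of a graph is a spanning subgraph all of whose components are cycles of length $k$. A 2-factorization is a partition of the edge set into 2-factors. $\mathrm{HWP}(v;m,n)$ is the set of pairs $(\alpha,\beta)$ such that $K_v$ ($v$ odd) or $K_v$ minus a 1-factor ($v$ even) has a 2-factorization into exactly $\alpha$ $C_m$-factors and $\beta$ $C_n$-factors. -}

module Defs where

open import Data.Nat using (ℕ; zero; suc; _≤_; _%_)
open import Data.Fin using (Fin)
open import Data.List using (List; []; _∷_; _++_; zip; concat; length; allFin; lookup)
open import Data.List.Relation.Unary.All using (All)
open import Data.List.Relation.Unary.Any using (Any)
open import Data.List.Membership.Propositional using (_∈_)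
open import Data.List.Relation.Binary.Permutation.Propositional using (_↭_)
open import Data.Product using (Σ; _×_; _,_)
open import Data.Sum using (_⊎_)
open import Relation.Binary.PropositionalEquality using (_≡_; _≢_)
open import Relation.Nullary using (¬_)

-- A cycle is given by its cyclic sequence of vertices [x₀, …, x_{k-1}].
-- Its edges are the consecutive pairs (x_i , x_{i+1}) and (x_{k-1} , x₀).
cycEdges : {A : Set} → List A → List (A × A)
cycEdges [] = []
cycEdges (x ∷ xs) = zip (x ∷ xs) (xs ++ (x ∷ []))

-- A 2-factor of a graph on vertex set Fin v: a collection of cycles
-- (each of length ≥ 3) whose vertex sequences together list every
-- vertex exactly once (so the cycles are vertex-disjoint and spanning).
record TwoFactor (v : ℕ) : Set where
  constructor mkTwoFactor
  field
    cycles   : List (List (Fin v))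
    long     : All (λ c → 3 ≤ length c) cycles
    spanning : concat cycles ↭ allFin v

open TwoFactor public

IsCkFactor : {v : ℕ} → ℕ → TwoFactor v → Set
IsCkFactor k F = All (λ c → length c ≡ k) (cycles F)

HasEdge : {v : ℕ} → TwoFactor v → Fin v → Fin v → Set
HasEdge F x y = Any (λ c → ((x , y) ∈ cycEdges c) ⊎ ((y , x) ∈ cycEdges c)) (cycles F)

IsTwoFactorization : {v : ℕ} → (Fin v → Fin v → Set) → List (TwoFactor v) → Set
IsTwoFactorization {v} G fs =
  (∀ (x y : Fin v) → G x y →
     Σ (Fin (length fs)) λ i → HasEdge (lookup fs i) x y ×
       (∀ (j : Fin (length fs)) → HasEdge (lookup fs j) x y → j ≡ i))
  × (∀ (x y : Fin v) → ¬ G x y → ∀ (i : Fin (length fs)) → ¬ HasEdge (lookup fs i) x y)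

Complete : (v : ℕ) → Fin v → Fin v → Set
Complete v x y = x ≢ y

-- A 1-factor (perfect matching) of K_v, given by the partner map p:
-- a fixed-point-free involution.
IsOneFactor : {v : ℕ} → (Fin v → Fin v) → Set
IsOneFactor {v} p = (∀ (x : Fin v) → p (p x) ≡ x) × (∀ (x : Fin v) → p x ≢ x)

CompleteMinus : (v : ℕ) → (Fin v → Fin v) → Fin v → Fin v → Set
CompleteMinus v p x y = (x ≢ y) × (y ≢ p x)

IsHWPFactorization : (v : ℕ) → List (TwoFactor v) → Set
IsHWPFactorization v fs =
  ((v % 2 ≡ 1) × IsTwoFactorization (Complete v) fs)
  ⊎ ((v % 2 ≡ 0) × Σ (Fin v → Fin v) λ p → IsOneFactor p × IsTwoFactorization (CompleteMinus v p) fs)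

HWP : (v m n α β : ℕ) → Set
HWP v m n α β =
  Σ (List (TwoFactor v)) λ Ms → Σ (List (TwoFactor v)) λ Ns →
    All (IsCkFactor m) Ms × All (IsCkFactor n) Ns ×
    length Ms ≡ α × length Ns ≡ β ×
    IsHWPFactorization v (Ms ++ Ns)

-- A 2-factor meets every vertex x in exactly two edges: in the cycle through x, x has one
-- successor and one predecessor, and they differ because the cycle has length at least 3.
-- In a 2-factorization of K_v minus a 1-factor the v - 2 edges at x are shared out among the
-- factors, so there are (v - 2) / 2 = 14 factors for v = 30, whatever their cycle lengths.
-- Conversely, for each α between 1 and 13 an explicit factorization of K₃₀ minus the 1-factor
-- {i , i + 15} into α C₃-factors and 14 - α C₅-factors is checked by evaluation: it is enough
-- that, for every vertex, the neighbours contributed by all factors sort to exactly its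
-- neighbours in the graph.

module Submission where

open import Defs
open import Data.Nat as ℕ using (ℕ; zero; suc; _+_; _*_; _≤_; _%_; s≤s)
import Data.Nat.Properties as ℕ
open import Data.Nat.DivMod using (_mod_)
open import Data.Fin using (Fin; zero; suc; toℕ)
open import Data.Fin.Properties using (_≟_; all?; ≤-decTotalOrder)
open import Data.List using (List; []; _∷_; _++_; _∷ʳ_; map; concat; concatMap; filter; length; tabulate; lookup; allFin; zip)
open import Data.List.Properties using (length-++; length-map; length-tabulate; map-++; filter-none; ≡-dec)
open import Data.List.Relation.Unary.All as All using (All; []; _∷_)
import Data.List.Relation.Unary.All.Properties as All
open import Data.List.Relation.Unary.Any using (here; there)
open import Data.List.Relation.Unary.Any.Properties using (Any-⊎⁺; Any-⊎⁻)
import Data.List.Relation.Unary.AllPairs.Properties as AllPairs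
open import Data.List.Relation.Unary.Unique.Propositional using (Unique; []; _∷_)
open import Data.List.Relation.Unary.Unique.Propositional.Properties using (concat⁺; filter⁺; allFin⁺) renaming (++⁺ to Unique-++⁺)
open import Data.List.Relation.Binary.Disjoint.Propositional using (Disjoint)
open import Data.List.Membership.Propositional using (_∈_)
open import Data.List.Membership.Propositional.Properties
  using (∈-++⁺ˡ; ∈-++⁺ʳ; ∈-++⁻; ∈-map⁺; ∈-concat⁺′; ∈-concat⁻′; ∈-tabulate⁺; ∈-tabulate⁻;
         ∈-concatMap⁺; ∈-concatMap⁻; ∈-filter⁺; ∈-filter⁻; ∈-map∘filter⁺; ∈-map∘filter⁻; ∈-allFin)
open import Data.List.Membership.Propositional.Properties.WithK using (unique∧set⇒bag)
open import Data.List.Relation.Binary.Permutation.Propositional using (_↭_; ↭-refl; ↭-sym; ↭-trans; ↭-reflexive; ↭⇒↭ₛ)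
open import Data.List.Relation.Binary.Permutation.Propositional.Properties using (∈-resp-↭; ∷↭∷ʳ; ↭-length) renaming (++⁺ to ↭-++⁺)
import Data.List.Relation.Binary.Permutation.Setoid.Properties as PermutationSetoid
open import Data.List.Relation.Binary.BagAndSetEquality using (∼bag⇒↭)
import Data.List.Sort.InsertionSort.Base as InsertionSort
import Data.List.Sort.InsertionSort.Properties as InsertionSortProperties
open import Data.Product using (Σ; ∃; _×_; _,_; proj₁; proj₂)
open import Data.Sum using (inj₁; inj₂)
open import Data.Empty using (⊥; ⊥-elim)
open import Function using (_∘_)
open import Function.Bundles using (_⇔_; mk⇔)
open import Relation.Binary.Definitions using (DecidableEquality)
open import Relation.Nullary using (¬_; Dec; yes; no; ¬?; contradiction)
open import Relation.Nullary.Decidable using (True; toWitness; from-yes; _×-dec_)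
open import Relation.Binary.PropositionalEquality
  using (_≡_; _≢_; refl; sym; trans; cong; cong₂; subst; subst₂; setoid; module ≡-Reasoning)

module _ {A : Set} where

  Unique-resp-↭ : {xs ys : List A} → xs ↭ ys → Unique xs → Unique ys
  Unique-resp-↭ p = PermutationSetoid.Unique-resp-↭ (setoid A) (↭⇒↭ₛ p)

  Unique-++⁻ : ∀ (xs : List A) {ys} → Unique (xs ++ ys) → Unique xs × Unique ys × Disjoint xs ys
  Unique-++⁻ [] u = [] , u , λ ()
  Unique-++⁻ (x ∷ xs) (x∉ ∷ u) with Unique-++⁻ xs u
  ... | uxs , uys , disjoint =
    All.++⁻ˡ xs x∉ ∷ uxs , uys , λ where
      (here refl , y∈ys) → All.lookup (All.++⁻ʳ xs x∉) y∈ys refl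
      (there y∈xs , y∈ys) → disjoint (y∈xs , y∈ys)

  Unique-singleton : {xs : List A} → length xs ≡ 1 → Unique xs
  Unique-singleton {_ ∷ []} _ = [] ∷ []

  unique∧set⇒↭ : {xs ys : List A} → Unique xs → Unique ys →
                           (∀ {z} → z ∈ xs ⇔ z ∈ ys) → xs ↭ ys
  unique∧set⇒↭ uxs uys same = ∼bag⇒↭ (unique∧set⇒bag uxs uys same)

  ∈-concat-tabulate⁺ : ∀ {n} (f : Fin n → List A) {a} i → a ∈ f i → a ∈ concat (tabulate f)
  ∈-concat-tabulate⁺ f i a∈ = ∈-concat⁺′ a∈ (∈-tabulate⁺ i)

  ∈-concat-tabulate⁻ : ∀ {n} (f : Fin n → List A) {a} → a ∈ concat (tabulate f) → ∃ λ i → a ∈ f i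
  ∈-concat-tabulate⁻ f a∈ with ∈-concat⁻′ _ a∈
  ... | xs , a∈xs , xs∈ with ∈-tabulate⁻ {f = f} xs∈
  ...   | i , refl = i , a∈xs

  length-concat-tabulate : ∀ {n k} (f : Fin n → List A) → (∀ i → length (f i) ≡ k) →
                           length (concat (tabulate f)) ≡ n * k
  length-concat-tabulate {zero} f _ = refl
  length-concat-tabulate {suc n} f len = trans (length-++ (f zero))
    (cong₂ _+_ (len zero) (length-concat-tabulate (f ∘ suc) (len ∘ suc)))

  Unique-concat-tabulate⁺ : ∀ {n} (f : Fin n → List A) → (∀ i → Unique (f i)) →
                            (∀ {i j} → i ≢ j → Disjoint (f i) (f j)) → Unique (concat (tabulate f))
  Unique-concat-tabulate⁺ f unique disjoint = concat⁺ (All.tabulate⁺ unique) (AllPairs.tabulate⁺ disjoint)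

  Unique-concat-tabulate⁻ : ∀ {n} (f : Fin n → List A) {a} → Unique (concat (tabulate f)) →
                            ∀ {i j} → a ∈ f i → a ∈ f j → i ≡ j
  Unique-concat-tabulate⁻ {suc n} f u {zero} {zero} _ _ = refl
  Unique-concat-tabulate⁻ {suc n} f u {zero} {suc j} a∈ a∈′ =
    let _ , _ , disjoint = Unique-++⁻ (f zero) u in ⊥-elim (disjoint (a∈ , ∈-concat-tabulate⁺ (f ∘ suc) j a∈′))
  Unique-concat-tabulate⁻ {suc n} f u {suc i} {zero} a∈ a∈′ =
    let _ , _ , disjoint = Unique-++⁻ (f zero) u in ⊥-elim (disjoint (a∈′ , ∈-concat-tabulate⁺ (f ∘ suc) i a∈))
  Unique-concat-tabulate⁻ {suc n} f u {suc i} {suc j} a∈ a∈′ =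
    let _ , unique-rest , _ = Unique-++⁻ (f zero) u in cong suc (Unique-concat-tabulate⁻ (f ∘ suc) unique-rest a∈ a∈′)

module _ {A B : Set} (_≟ᴮ_ : DecidableEquality B) (f : A → B) where

  length-filter-unique : ∀ {b} xs → Unique (map f xs) → b ∈ map f xs →
                         length (filter (λ a → f a ≟ᴮ b) xs) ≡ 1
  length-filter-unique {b} (a ∷ xs) (fa∉ ∷ u) b∈ with f a ≟ᴮ b
  ... | yes refl = cong suc (cong length (filter-none (λ a′ → f a′ ≟ᴮ f a)
                     (All.map (λ fa≢ eq → fa≢ (sym eq)) (All.map⁻ fa∉))))
  ... | no fa≢b with b∈
  ...   | here b≡fa = contradiction (sym b≡fa) fa≢b
  ...   | there b∈′ = length-filter-unique xs u b∈′

module _ {A : Set} where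

  walkEdges : A → List A → A → List (A × A)
  walkEdges a bs z = zip (a ∷ bs) (bs ∷ʳ z)

  map-proj₁-walkEdges : ∀ a bs (z : A) → map proj₁ (walkEdges a bs z) ≡ a ∷ bs
  map-proj₁-walkEdges a [] z = refl
  map-proj₁-walkEdges a (b ∷ bs) z = cong (a ∷_) (map-proj₁-walkEdges b bs z)

  map-proj₂-walkEdges : ∀ a bs (z : A) → map proj₂ (walkEdges a bs z) ≡ bs ∷ʳ z
  map-proj₂-walkEdges a [] z = refl
  map-proj₂-walkEdges a (b ∷ bs) z = cong (b ∷_) (map-proj₂-walkEdges b bs z)

  walkEdges-source : ∀ {x y : A} a bs z → (x , y) ∈ walkEdges a bs z → x ∈ a ∷ bs
  walkEdges-source {x} a bs z e = subst (x ∈_) (map-proj₁-walkEdges a bs z) (∈-map⁺ proj₁ e)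

  walkEdges-target : ∀ {x y : A} a bs z → (x , y) ∈ walkEdges a bs z → y ∈ bs ∷ʳ z
  walkEdges-target {y = y} a bs z e = subst (y ∈_) (map-proj₂-walkEdges a bs z) (∈-map⁺ proj₂ e)

  path-no-reversed-edge : ∀ {x y : A} a bs z → Unique (a ∷ bs ∷ʳ z) →
                          (x , y) ∈ walkEdges a bs z → (y , x) ∈ walkEdges a bs z → ⊥
  path-no-reversed-edge a [] z (a∉ ∷ _) (here refl) (here refl) = All.head a∉ refl
  path-no-reversed-edge a [] z _ (here refl) (there ())
  path-no-reversed-edge a [] z _ (there ()) _
  path-no-reversed-edge a (b ∷ bs) z (a∉ ∷ _) (here refl) (here refl) = All.head a∉ refl
  path-no-reversed-edge a (b ∷ bs) z (a∉ ∷ _) (here refl) (there e) =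
    All.lookup a∉ (there (walkEdges-target b bs z e)) refl
  path-no-reversed-edge a (b ∷ bs) z (a∉ ∷ _) (there e) (here refl) =
    All.lookup a∉ (there (walkEdges-target b bs z e)) refl
  path-no-reversed-edge a (b ∷ bs) z (_ ∷ u) (there e) (there e′) = path-no-reversed-edge b bs z u e e′

  cycle-second-not-before-first : ∀ (a b b′ : A) bs → Unique (a ∷ b ∷ b′ ∷ bs) →
                                  (b , a) ∈ walkEdges b (b′ ∷ bs) a → ⊥
  cycle-second-not-before-first a b b′ bs (a∉ ∷ _) (here refl) = All.lookup a∉ (there (here refl)) refl
  cycle-second-not-before-first a b b′ bs (_ ∷ b∉ ∷ _) (there e) =
    All.lookup b∉ (walkEdges-source b′ bs a e) refl

  cycle-no-reversed-edge : ∀ {x y : A} c → 3 ≤ length c → Unique c →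
                           (x , y) ∈ cycEdges c → (y , x) ∈ cycEdges c → ⊥
  cycle-no-reversed-edge (a ∷ b ∷ b′ ∷ bs) _ (a∉ ∷ _) (here refl) (here refl) = All.head a∉ refl
  cycle-no-reversed-edge (a ∷ b ∷ b′ ∷ bs) _ u (here refl) (there e) = cycle-second-not-before-first a b b′ bs u e
  cycle-no-reversed-edge (a ∷ b ∷ b′ ∷ bs) _ u (there e) (here refl) = cycle-second-not-before-first a b b′ bs u e
  cycle-no-reversed-edge (a ∷ b ∷ b′ ∷ bs) _ u (there e) (there e′) =
    path-no-reversed-edge b (b′ ∷ bs) a (Unique-resp-↭ (∷↭∷ʳ a (b ∷ b′ ∷ bs)) u) e e′
  cycle-no-reversed-edge (_ ∷ _ ∷ []) (s≤s (s≤s ()))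
  cycle-no-reversed-edge (_ ∷ []) (s≤s ())
  cycle-no-reversed-edge [] ()

  map-proj₁-cycEdges : ∀ (c : List A) → map proj₁ (cycEdges c) ≡ c
  map-proj₁-cycEdges [] = refl
  map-proj₁-cycEdges (a ∷ bs) = map-proj₁-walkEdges a bs a

  map-proj₂-cycEdges : ∀ (c : List A) → map proj₂ (cycEdges c) ↭ c
  map-proj₂-cycEdges [] = ↭-refl
  map-proj₂-cycEdges (a ∷ bs) = ↭-trans (↭-reflexive (map-proj₂-walkEdges a bs a)) (↭-sym (∷↭∷ʳ a bs))

  cycEdges-source : ∀ {x y : A} c → (x , y) ∈ cycEdges c → x ∈ c
  cycEdges-source {x} c e = subst (x ∈_) (map-proj₁-cycEdges c) (∈-map⁺ proj₁ e)

  cycEdges-target : ∀ {x y : A} c → (x , y) ∈ cycEdges c → y ∈ c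
  cycEdges-target c e = ∈-resp-↭ (map-proj₂-cycEdges c) (∈-map⁺ proj₂ e)

  edges : List (List A) → List (A × A)
  edges = concatMap cycEdges

  map-proj₁-edges : ∀ cs → map proj₁ (edges cs) ≡ concat cs
  map-proj₁-edges [] = refl
  map-proj₁-edges (c ∷ cs) = trans (map-++ proj₁ (cycEdges c) (edges cs))
    (cong₂ _++_ (map-proj₁-cycEdges c) (map-proj₁-edges cs))

  map-proj₂-edges : ∀ cs → map proj₂ (edges cs) ↭ concat cs
  map-proj₂-edges [] = ↭-refl
  map-proj₂-edges (c ∷ cs) = ↭-trans (↭-reflexive (map-++ proj₂ (cycEdges c) (edges cs)))
    (↭-++⁺ (map-proj₂-cycEdges c) (map-proj₂-edges cs))

  edges-source : ∀ {x y : A} cs → (x , y) ∈ edges cs → x ∈ concat cs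
  edges-source {x} cs e = subst (x ∈_) (map-proj₁-edges cs) (∈-map⁺ proj₁ e)

  edges-target : ∀ {x y : A} cs → (x , y) ∈ edges cs → y ∈ concat cs
  edges-target cs e = ∈-resp-↭ (map-proj₂-edges cs) (∈-map⁺ proj₂ e)

  edges-no-reversed-edge : ∀ {x y : A} cs → All (λ c → 3 ≤ length c) cs → Unique (concat cs) →
                           (x , y) ∈ edges cs → (y , x) ∈ edges cs → ⊥
  edges-no-reversed-edge (c ∷ cs) (3≤c ∷ 3≤cs) u xy∈ yx∈
    with Unique-++⁻ c u | ∈-++⁻ (cycEdges c) xy∈ | ∈-++⁻ (cycEdges c) yx∈
  ... | uc , _ , _ | inj₁ xy∈c | inj₁ yx∈c = cycle-no-reversed-edge c 3≤c uc xy∈c yx∈c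
  ... | _ , _ , disjoint | inj₁ xy∈c | inj₂ yx∈cs = disjoint (cycEdges-source c xy∈c , edges-target cs yx∈cs)
  ... | _ , _ , disjoint | inj₂ xy∈cs | inj₁ yx∈c = disjoint (cycEdges-target c yx∈c , edges-source cs xy∈cs)
  ... | _ , ucs , _ | inj₂ xy∈cs | inj₂ yx∈cs = edges-no-reversed-edge cs 3≤cs ucs xy∈cs yx∈cs

module _ {v : ℕ} where

  successors : Fin v → List (Fin v × Fin v) → List (Fin v)
  successors x es = map proj₂ (filter (λ e → proj₁ e ≟ x) es)

  predecessors : Fin v → List (Fin v × Fin v) → List (Fin v)
  predecessors x es = map proj₁ (filter (λ e → proj₂ e ≟ x) es)

  ∈-successors⁺ : ∀ {x y es} → (x , y) ∈ es → y ∈ successors x es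
  ∈-successors⁺ {x} {y} e = ∈-map∘filter⁺ proj₂ (λ e → proj₁ e ≟ x) ((x , y) , e , refl , refl)

  ∈-successors⁻ : ∀ {x y es} → y ∈ successors x es → (x , y) ∈ es
  ∈-successors⁻ {x} y∈ with ∈-map∘filter⁻ proj₂ (λ e → proj₁ e ≟ x) y∈
  ... | _ , e , refl , refl = e

  ∈-predecessors⁺ : ∀ {x y es} → (y , x) ∈ es → y ∈ predecessors x es
  ∈-predecessors⁺ {x} {y} e = ∈-map∘filter⁺ proj₁ (λ e → proj₂ e ≟ x) ((y , x) , e , refl , refl)

  ∈-predecessors⁻ : ∀ {x y es} → y ∈ predecessors x es → (y , x) ∈ es
  ∈-predecessors⁻ {x} y∈ with ∈-map∘filter⁻ proj₁ (λ e → proj₂ e ≟ x) y∈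
  ... | _ , e , refl , refl = e

  neighbours : TwoFactor v → Fin v → List (Fin v)
  neighbours F x = successors x (edges (cycles F)) ++ predecessors x (edges (cycles F))

  ∈-neighbours⁻ : ∀ F {x y} → y ∈ neighbours F x → HasEdge F x y
  ∈-neighbours⁻ F {x} y∈ with ∈-++⁻ (successors x (edges (cycles F))) y∈
  ... | inj₁ y∈s = Any-⊎⁺ (inj₁ (∈-concatMap⁻ cycEdges (∈-successors⁻ y∈s)))
  ... | inj₂ y∈p = Any-⊎⁺ (inj₂ (∈-concatMap⁻ cycEdges (∈-predecessors⁻ y∈p)))

  ∈-neighbours⁺ : ∀ F {x y} → HasEdge F x y → y ∈ neighbours F x
  ∈-neighbours⁺ F h with Any-⊎⁻ h
  ... | inj₁ e = ∈-++⁺ˡ (∈-successors⁺ (∈-concatMap⁺ cycEdges e))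
  ... | inj₂ e = ∈-++⁺ʳ _ (∈-predecessors⁺ (∈-concatMap⁺ cycEdges e))

  occurs-once : ∀ {A : Set} (f : A → Fin v) {es} → map f es ↭ allFin v →
                ∀ x → length (filter (λ e → f e ≟ x) es) ≡ 1
  occurs-once f {es} f[es]↭ x = length-filter-unique _≟_ f es
    (Unique-resp-↭ (↭-sym f[es]↭) (allFin⁺ v)) (∈-resp-↭ (↭-sym f[es]↭) (∈-allFin x))

module _ {v : ℕ} (F : TwoFactor v) where

  length-successors : ∀ x → length (successors x (edges (cycles F))) ≡ 1
  length-successors x = trans (length-map proj₂ (filter (λ e → proj₁ e ≟ x) (edges (cycles F))))
    (occurs-once proj₁ (↭-trans (↭-reflexive (map-proj₁-edges (cycles F))) (spanning F)) x)

  length-predecessors : ∀ x → length (predecessors x (edges (cycles F))) ≡ 1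
  length-predecessors x = trans (length-map proj₁ (filter (λ e → proj₂ e ≟ x) (edges (cycles F))))
    (occurs-once proj₂ (↭-trans (map-proj₂-edges (cycles F)) (spanning F)) x)

  length-neighbours : ∀ x → length (neighbours F x) ≡ 2
  length-neighbours x = trans (length-++ (successors x (edges (cycles F))))
    (cong₂ _+_ (length-successors x) (length-predecessors x))

  Unique-neighbours : ∀ x → Unique (neighbours F x)
  Unique-neighbours x = Unique-++⁺ (Unique-singleton (length-successors x)) (Unique-singleton (length-predecessors x))
    λ (y∈s , y∈p) → edges-no-reversed-edge (cycles F) (long F) (Unique-resp-↭ (↭-sym (spanning F)) (allFin⁺ v))
                      (∈-successors⁻ y∈s) (∈-predecessors⁻ y∈p)

allNeighbours : ∀ {v} → List (TwoFactor v) → Fin v → List (Fin v)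
allNeighbours fs x = concat (tabulate λ i → neighbours (lookup fs i) x)

length-allNeighbours : ∀ {v} (fs : List (TwoFactor v)) x → length (allNeighbours fs x) ≡ length fs * 2
length-allNeighbours fs x = length-concat-tabulate _ λ i → length-neighbours (lookup fs i) x

module _ {v : ℕ} {G : Fin v → Fin v → Set} (G? : ∀ x y → Dec (G x y)) where

  neighbourhood : Fin v → List (Fin v)
  neighbourhood x = filter (G? x) (allFin v)

  ∈-neighbourhood⁺ : ∀ {x y} → G x y → y ∈ neighbourhood x
  ∈-neighbourhood⁺ {x} g = ∈-filter⁺ (G? x) (∈-allFin _) g

  ∈-neighbourhood⁻ : ∀ {x y} → y ∈ neighbourhood x → G x y
  ∈-neighbourhood⁻ {x} y∈ = proj₂ (∈-filter⁻ (G? x) {xs = allFin v} y∈)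

  Unique-neighbourhood : ∀ x → Unique (neighbourhood x)
  Unique-neighbourhood x = filter⁺ (G? x) (allFin⁺ v)

  module _ (fs : List (TwoFactor v)) where

    twoFactorization⇒allNeighbours↭ : IsTwoFactorization G fs → ∀ x → allNeighbours fs x ↭ neighbourhood x
    twoFactorization⇒allNeighbours↭ (cover , exclude) x =
      unique∧set⇒↭ (Unique-concat-tabulate⁺ _ (λ i → Unique-neighbours (lookup fs i) x) disjoint)
                             (Unique-neighbourhood x) (mk⇔ to from)
      where
      adjacent : ∀ {i y} → HasEdge (lookup fs i) x y → G x y
      adjacent {i} {y} h with G? x y
      ... | yes g = g
      ... | no ¬g = contradiction h (exclude x y ¬g i)

      same-factor : ∀ {i j y} → HasEdge (lookup fs i) x y → HasEdge (lookup fs j) x y → i ≡ j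
      same-factor hᵢ hⱼ with cover x _ (adjacent hᵢ)
      ... | _ , _ , unique = trans (unique _ hᵢ) (sym (unique _ hⱼ))

      to : ∀ {y} → y ∈ allNeighbours fs x → y ∈ neighbourhood x
      to y∈ with ∈-concat-tabulate⁻ _ y∈
      ... | i , y∈i = ∈-neighbourhood⁺ (adjacent (∈-neighbours⁻ (lookup fs i) y∈i))

      from : ∀ {y} → y ∈ neighbourhood x → y ∈ allNeighbours fs x
      from {y} y∈ with cover x y (∈-neighbourhood⁻ y∈)
      ... | i , h , _ = ∈-concat-tabulate⁺ _ i (∈-neighbours⁺ (lookup fs i) h)

      disjoint : ∀ {i j} → i ≢ j → Disjoint (neighbours (lookup fs i) x) (neighbours (lookup fs j) x)
      disjoint {i} {j} i≢j (y∈i , y∈j) =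
        i≢j (same-factor (∈-neighbours⁻ (lookup fs i) y∈i) (∈-neighbours⁻ (lookup fs j) y∈j))

    allNeighbours↭⇒twoFactorization : (∀ x → allNeighbours fs x ↭ neighbourhood x) → IsTwoFactorization G fs
    allNeighbours↭⇒twoFactorization same = cover , exclude
      where
      cover : ∀ x y → G x y → Σ (Fin (length fs)) λ i → HasEdge (lookup fs i) x y ×
                (∀ j → HasEdge (lookup fs j) x y → j ≡ i)
      cover x y g with ∈-concat-tabulate⁻ _ (∈-resp-↭ (↭-sym (same x)) (∈-neighbourhood⁺ g))
      ... | i , y∈i = i , ∈-neighbours⁻ (lookup fs i) y∈i , λ j h →
        Unique-concat-tabulate⁻ _ (Unique-resp-↭ (↭-sym (same x)) (Unique-neighbourhood x))
          (∈-neighbours⁺ (lookup fs j) h) y∈i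

      exclude : ∀ x y → ¬ G x y → ∀ i → ¬ HasEdge (lookup fs i) x y
      exclude x y ¬g i h =
        ¬g (∈-neighbourhood⁻ (∈-resp-↭ (same x) (∈-concat-tabulate⁺ _ i (∈-neighbours⁺ (lookup fs i) h))))

CompleteMinus? : ∀ {v} (p : Fin v → Fin v) x y → Dec (CompleteMinus v p x y)
CompleteMinus? p x y = ¬? (x ≟ y) ×-dec ¬? (y ≟ p x)

length-neighbourhood-CompleteMinus : ∀ {v} (p : Fin v → Fin v) x → p x ≢ x →
                                     2 + length (neighbourhood (CompleteMinus? p) x) ≡ v
length-neighbourhood-CompleteMinus {v} p x px≢x = trans (↭-length everyVertex) (length-tabulate (λ y → y))
  where
  others : List (Fin v)
  others = neighbourhood (CompleteMinus? p) x

  x∉ : ∀ {y} → y ∈ p x ∷ others → x ≢ y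
  x∉ (here refl) = px≢x ∘ sym
  x∉ (there y∈) = proj₁ (∈-neighbourhood⁻ (CompleteMinus? p) y∈)

  px∉ : ∀ {y} → y ∈ others → p x ≢ y
  px∉ y∈ = proj₂ (∈-neighbourhood⁻ (CompleteMinus? p) y∈) ∘ sym

  every : ∀ {y} → y ∈ allFin v → y ∈ x ∷ p x ∷ others
  every {y} _ with y ≟ x | y ≟ p x
  ... | yes refl | _ = here refl
  ... | no _ | yes refl = there (here refl)
  ... | no y≢x | no y≢px = there (there (∈-neighbourhood⁺ (CompleteMinus? p) (y≢x ∘ sym , y≢px)))

  everyVertex : x ∷ p x ∷ others ↭ allFin v
  everyVertex = unique∧set⇒↭ (All.tabulate x∉ ∷ All.tabulate px∉ ∷ Unique-neighbourhood (CompleteMinus? p) x)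
                             (allFin⁺ v) (mk⇔ (λ _ → ∈-allFin _) every)

twoFactorization-size : ∀ {v p} (fs : List (TwoFactor v)) → Fin v → IsOneFactor p →
                        IsTwoFactorization (CompleteMinus v p) fs → 2 + length fs * 2 ≡ v
twoFactorization-size {v} {p} fs x (_ , no-fixpoint) factorization = begin
  2 + length fs * 2                                ≡⟨ cong (2 +_) (sym (length-allNeighbours fs x)) ⟩
  2 + length (allNeighbours fs x)                  ≡⟨ cong (2 +_) (↭-length allNeighbours↭neighbourhood) ⟩
  2 + length (neighbourhood (CompleteMinus? p) x)  ≡⟨ length-neighbourhood-CompleteMinus p x (no-fixpoint x) ⟩
  v                                                ∎
  where
  open ≡-Reasoning
  allNeighbours↭neighbourhood : allNeighbours fs x ↭ neighbourhood (CompleteMinus? p) x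
  allNeighbours↭neighbourhood = twoFactorization⇒allNeighbours↭ (CompleteMinus? p) fs factorization x

hwp-size : ∀ {v m n α β} → Fin v → v % 2 ≡ 0 → HWP v m n α β → 2 + (α + β) * 2 ≡ v
hwp-size x even (_ , _ , _ , _ , refl , refl , inj₁ (odd , _)) = contradiction (trans (sym even) odd) λ ()
hwp-size x even (Ms , Ns , _ , _ , refl , refl , inj₂ (_ , _ , p-1F , factorization)) =
  trans (cong (λ n → 2 + n * 2) (sym (length-++ Ms))) (twoFactorization-size (Ms ++ Ns) x p-1F factorization)

module _ {v : ℕ} where

  open InsertionSort (≤-decTotalOrder v) using (sort)
  open InsertionSortProperties (≤-decTotalOrder v) using (sort-↭)

  sort≡⇒↭ : ∀ {xs ys} → sort xs ≡ ys → xs ↭ ys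
  sort≡⇒↭ {xs} eq = ↭-trans (↭-sym (sort-↭ xs)) (↭-reflexive eq)

  IsCkCycles : ℕ → List (List (Fin v)) → Set
  IsCkCycles k cs = All (λ c → length c ≡ k) cs × sort (concat cs) ≡ allFin v

  isCkCycles? : ∀ k cs → Dec (IsCkCycles k cs)
  isCkCycles? k cs = All.all? (λ c → length c ℕ.≟ k) cs ×-dec ≡-dec _≟_ (sort (concat cs)) (allFin v)

  module _ {k : ℕ} (3≤k : 3 ≤ k) where

    ckFactor : ∀ {cs} → IsCkCycles k cs → TwoFactor v
    ckFactor {cs} (lengths , sorted) =
      mkTwoFactor cs (All.map (λ eq → subst (3 ≤_) (sym eq) 3≤k) lengths) (sort≡⇒↭ sorted)

    ckFactors : ∀ {css} → All (IsCkCycles k) css → List (TwoFactor v)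
    ckFactors [] = []
    ckFactors (c ∷ cs) = ckFactor c ∷ ckFactors cs

    ckFactors-areCk : ∀ {css} (cs : All (IsCkCycles k) css) → All (IsCkFactor k) (ckFactors cs)
    ckFactors-areCk [] = []
    ckFactors-areCk ((lengths , _) ∷ cs) = lengths ∷ ckFactors-areCk cs

    length-ckFactors : ∀ {css} (cs : All (IsCkCycles k) css) → length (ckFactors cs) ≡ length css
    length-ckFactors [] = refl
    length-ckFactors (_ ∷ cs) = cong suc (length-ckFactors cs)

  SortedNeighboursMatch : (Fin v → Fin v) → List (TwoFactor v) → Set
  SortedNeighboursMatch p fs = ∀ x → sort (allNeighbours fs x) ≡ neighbourhood (CompleteMinus? p) x

  sortedNeighboursMatch? : ∀ p fs → Dec (SortedNeighboursMatch p fs)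
  sortedNeighboursMatch? p fs = all? λ x → ≡-dec _≟_ (sort (allNeighbours fs x)) (neighbourhood (CompleteMinus? p) x)

  hwp-from-cycles : ∀ {m n p} {mss nss : List (List (List (Fin v)))} → v % 2 ≡ 0 → IsOneFactor p →
                    (3≤m : 3 ≤ m) (3≤n : 3 ≤ n) (ms : All (IsCkCycles m) mss) (ns : All (IsCkCycles n) nss) →
                    SortedNeighboursMatch p (ckFactors 3≤m ms ++ ckFactors 3≤n ns) →
                    HWP v m n (length mss) (length nss)
  hwp-from-cycles {p = p} even p-1F 3≤m 3≤n ms ns match =
    ckFactors 3≤m ms , ckFactors 3≤n ns , ckFactors-areCk 3≤m ms , ckFactors-areCk 3≤n ns ,
    length-ckFactors 3≤m ms , length-ckFactors 3≤n ns ,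
    inj₂ (even , p , p-1F ,
          allNeighbours↭⇒twoFactorization (CompleteMinus? p) (ckFactors 3≤m ms ++ ckFactors 3≤n ns) (sort≡⇒↭ ∘ match))

opposite : Fin 30 → Fin 30
opposite i = (toℕ i + 15) mod 30

opposite-isOneFactor : IsOneFactor opposite
opposite-isOneFactor = from-yes (all? (λ x → opposite (opposite x) ≟ x) ×-dec all? (λ x → ¬? (opposite x ≟ x)))

toVertices : List (List (List ℕ)) → List (List (List (Fin 30)))
toVertices = map (map (map (_mod 30)))

hwp₃₀-from-cycles : (triangles pentagons : List (List (List ℕ))) →
  {ts : True (All.all? (isCkCycles? 3) (toVertices triangles))} →
  {ps : True (All.all? (isCkCycles? 5) (toVertices pentagons))} →
  {_ : True (sortedNeighboursMatch? opposite (ckFactors ℕ.≤-refl (toWitness ts) ++ ckFactors (ℕ.m≤m+n 3 2) (toWitness ps)))} →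
  HWP 30 3 5 (length triangles) (length pentagons)
hwp₃₀-from-cycles triangles pentagons {ts} {ps} {match} =
  subst₂ (HWP 30 3 5) (length-map _ triangles) (length-map _ pentagons)
    (hwp-from-cycles refl opposite-isOneFactor ℕ.≤-refl (ℕ.m≤m+n 3 2) (toWitness ts) (toWitness ps) (toWitness match))

hwp₃₀ : ∀ α β → 1 ≤ α → 1 ≤ β → α + β ≡ 14 → HWP 30 3 5 α β
hwp₃₀ 1 _ _ _ refl = hwp₃₀-from-cycles
  ( ((0 ∷ 5 ∷ 10 ∷ []) ∷ (15 ∷ 20 ∷ 25 ∷ []) ∷ (1 ∷ 6 ∷ 11 ∷ []) ∷ (16 ∷ 21 ∷ 26 ∷ []) ∷ (2 ∷ 7 ∷ 12 ∷ []) ∷ (17 ∷ 22 ∷ 27 ∷ []) ∷ (3 ∷ 8 ∷ 13 ∷ []) ∷ (18 ∷ 23 ∷ 28 ∷ []) ∷ (4 ∷ 9 ∷ 14 ∷ []) ∷ (19 ∷ 24 ∷ 29 ∷ []) ∷ []) ∷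
    []
  )
  ( ((1 ∷ 10 ∷ 4 ∷ 13 ∷ 7 ∷ []) ∷ (19 ∷ 2 ∷ 3 ∷ 23 ∷ 27 ∷ []) ∷ (22 ∷ 5 ∷ 6 ∷ 26 ∷ 15 ∷ []) ∷ (25 ∷ 8 ∷ 9 ∷ 29 ∷ 18 ∷ []) ∷ (28 ∷ 11 ∷ 12 ∷ 17 ∷ 21 ∷ []) ∷ (16 ∷ 14 ∷ 0 ∷ 20 ∷ 24 ∷ []) ∷ []) ∷
    ((2 ∷ 11 ∷ 5 ∷ 14 ∷ 8 ∷ []) ∷ (20 ∷ 3 ∷ 4 ∷ 24 ∷ 28 ∷ []) ∷ (23 ∷ 6 ∷ 7 ∷ 27 ∷ 16 ∷ []) ∷ (26 ∷ 9 ∷ 10 ∷ 15 ∷ 19 ∷ []) ∷ (29 ∷ 12 ∷ 13 ∷ 18 ∷ 22 ∷ []) ∷ (17 ∷ 0 ∷ 1 ∷ 21 ∷ 25 ∷ []) ∷ []) ∷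
    ((3 ∷ 12 ∷ 6 ∷ 0 ∷ 9 ∷ []) ∷ (21 ∷ 4 ∷ 5 ∷ 25 ∷ 29 ∷ []) ∷ (24 ∷ 7 ∷ 8 ∷ 28 ∷ 17 ∷ []) ∷ (27 ∷ 10 ∷ 11 ∷ 16 ∷ 20 ∷ []) ∷ (15 ∷ 13 ∷ 14 ∷ 19 ∷ 23 ∷ []) ∷ (18 ∷ 1 ∷ 2 ∷ 22 ∷ 26 ∷ []) ∷ []) ∷
    ((9 ∷ 5 ∷ 12 ∷ 18 ∷ 17 ∷ []) ∷ (14 ∷ 10 ∷ 2 ∷ 23 ∷ 22 ∷ []) ∷ (4 ∷ 0 ∷ 7 ∷ 28 ∷ 27 ∷ []) ∷ (24 ∷ 15 ∷ 11 ∷ 13 ∷ 26 ∷ []) ∷ (29 ∷ 20 ∷ 1 ∷ 3 ∷ 16 ∷ []) ∷ (19 ∷ 25 ∷ 6 ∷ 8 ∷ 21 ∷ []) ∷ []) ∷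
    ((10 ∷ 6 ∷ 13 ∷ 19 ∷ 18 ∷ []) ∷ (0 ∷ 11 ∷ 3 ∷ 24 ∷ 23 ∷ []) ∷ (5 ∷ 1 ∷ 8 ∷ 29 ∷ 28 ∷ []) ∷ (25 ∷ 16 ∷ 12 ∷ 14 ∷ 27 ∷ []) ∷ (15 ∷ 21 ∷ 2 ∷ 4 ∷ 17 ∷ []) ∷ (20 ∷ 26 ∷ 7 ∷ 9 ∷ 22 ∷ []) ∷ []) ∷
    ((11 ∷ 7 ∷ 14 ∷ 20 ∷ 19 ∷ []) ∷ (1 ∷ 12 ∷ 4 ∷ 25 ∷ 24 ∷ []) ∷ (6 ∷ 2 ∷ 9 ∷ 15 ∷ 29 ∷ []) ∷ (26 ∷ 17 ∷ 13 ∷ 0 ∷ 28 ∷ []) ∷ (16 ∷ 22 ∷ 3 ∷ 5 ∷ 18 ∷ []) ∷ (21 ∷ 27 ∷ 8 ∷ 10 ∷ 23 ∷ []) ∷ []) ∷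
    ((12 ∷ 8 ∷ 0 ∷ 21 ∷ 20 ∷ []) ∷ (2 ∷ 13 ∷ 5 ∷ 26 ∷ 25 ∷ []) ∷ (7 ∷ 3 ∷ 10 ∷ 16 ∷ 15 ∷ []) ∷ (27 ∷ 18 ∷ 14 ∷ 1 ∷ 29 ∷ []) ∷ (17 ∷ 23 ∷ 4 ∷ 6 ∷ 19 ∷ []) ∷ (22 ∷ 28 ∷ 9 ∷ 11 ∷ 24 ∷ []) ∷ []) ∷
    ((13 ∷ 9 ∷ 1 ∷ 22 ∷ 21 ∷ []) ∷ (3 ∷ 14 ∷ 6 ∷ 27 ∷ 26 ∷ []) ∷ (8 ∷ 4 ∷ 11 ∷ 17 ∷ 16 ∷ []) ∷ (28 ∷ 19 ∷ 0 ∷ 2 ∷ 15 ∷ []) ∷ (18 ∷ 24 ∷ 5 ∷ 7 ∷ 20 ∷ []) ∷ (23 ∷ 29 ∷ 10 ∷ 12 ∷ 25 ∷ []) ∷ []) ∷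
    ((7 ∷ 25 ∷ 1 ∷ 17 ∷ 29 ∷ []) ∷ (12 ∷ 15 ∷ 6 ∷ 22 ∷ 19 ∷ []) ∷ (2 ∷ 20 ∷ 11 ∷ 27 ∷ 24 ∷ []) ∷ (13 ∷ 10 ∷ 21 ∷ 9 ∷ 23 ∷ []) ∷ (3 ∷ 0 ∷ 26 ∷ 14 ∷ 28 ∷ []) ∷ (8 ∷ 5 ∷ 16 ∷ 4 ∷ 18 ∷ []) ∷ []) ∷
    ((8 ∷ 26 ∷ 2 ∷ 18 ∷ 15 ∷ []) ∷ (13 ∷ 16 ∷ 7 ∷ 23 ∷ 20 ∷ []) ∷ (3 ∷ 21 ∷ 12 ∷ 28 ∷ 25 ∷ []) ∷ (14 ∷ 11 ∷ 22 ∷ 10 ∷ 24 ∷ []) ∷ (4 ∷ 1 ∷ 27 ∷ 0 ∷ 29 ∷ []) ∷ (9 ∷ 6 ∷ 17 ∷ 5 ∷ 19 ∷ []) ∷ []) ∷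
    ((9 ∷ 27 ∷ 3 ∷ 19 ∷ 16 ∷ []) ∷ (14 ∷ 17 ∷ 8 ∷ 24 ∷ 21 ∷ []) ∷ (4 ∷ 22 ∷ 13 ∷ 29 ∷ 26 ∷ []) ∷ (0 ∷ 12 ∷ 23 ∷ 11 ∷ 25 ∷ []) ∷ (5 ∷ 2 ∷ 28 ∷ 1 ∷ 15 ∷ []) ∷ (10 ∷ 7 ∷ 18 ∷ 6 ∷ 20 ∷ []) ∷ []) ∷
    ((10 ∷ 28 ∷ 4 ∷ 20 ∷ 17 ∷ []) ∷ (0 ∷ 18 ∷ 9 ∷ 25 ∷ 22 ∷ []) ∷ (5 ∷ 23 ∷ 14 ∷ 15 ∷ 27 ∷ []) ∷ (1 ∷ 13 ∷ 24 ∷ 12 ∷ 26 ∷ []) ∷ (6 ∷ 3 ∷ 29 ∷ 2 ∷ 16 ∷ []) ∷ (11 ∷ 8 ∷ 19 ∷ 7 ∷ 21 ∷ []) ∷ []) ∷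
    ((11 ∷ 29 ∷ 5 ∷ 21 ∷ 18 ∷ []) ∷ (1 ∷ 19 ∷ 10 ∷ 26 ∷ 23 ∷ []) ∷ (6 ∷ 24 ∷ 0 ∷ 16 ∷ 28 ∷ []) ∷ (2 ∷ 14 ∷ 25 ∷ 13 ∷ 27 ∷ []) ∷ (7 ∷ 4 ∷ 15 ∷ 3 ∷ 17 ∷ []) ∷ (12 ∷ 9 ∷ 20 ∷ 8 ∷ 22 ∷ []) ∷ []) ∷
    []
  )

hwp₃₀ 2 _ _ _ refl = hwp₃₀-from-cycles
  ( ((24 ∷ 23 ∷ 25 ∷ []) ∷ (27 ∷ 26 ∷ 28 ∷ []) ∷ (15 ∷ 29 ∷ 16 ∷ []) ∷ (18 ∷ 17 ∷ 19 ∷ []) ∷ (21 ∷ 20 ∷ 22 ∷ []) ∷ (6 ∷ 7 ∷ 8 ∷ []) ∷ (9 ∷ 10 ∷ 11 ∷ []) ∷ (12 ∷ 13 ∷ 14 ∷ []) ∷ (0 ∷ 1 ∷ 2 ∷ []) ∷ (3 ∷ 4 ∷ 5 ∷ []) ∷ []) ∷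
    ((16 ∷ 17 ∷ 7 ∷ []) ∷ (19 ∷ 20 ∷ 10 ∷ []) ∷ (22 ∷ 23 ∷ 13 ∷ []) ∷ (25 ∷ 26 ∷ 1 ∷ []) ∷ (28 ∷ 29 ∷ 4 ∷ []) ∷ (12 ∷ 11 ∷ 21 ∷ []) ∷ (0 ∷ 14 ∷ 24 ∷ []) ∷ (3 ∷ 2 ∷ 27 ∷ []) ∷ (6 ∷ 5 ∷ 15 ∷ []) ∷ (9 ∷ 8 ∷ 18 ∷ []) ∷ []) ∷
    []
  )
  ( ((2 ∷ 8 ∷ 14 ∷ 5 ∷ 11 ∷ []) ∷ (9 ∷ 4 ∷ 18 ∷ 29 ∷ 19 ∷ []) ∷ (12 ∷ 7 ∷ 21 ∷ 17 ∷ 22 ∷ []) ∷ (0 ∷ 10 ∷ 24 ∷ 20 ∷ 25 ∷ []) ∷ (3 ∷ 13 ∷ 27 ∷ 23 ∷ 28 ∷ []) ∷ (6 ∷ 1 ∷ 15 ∷ 26 ∷ 16 ∷ []) ∷ []) ∷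
    ((2 ∷ 5 ∷ 8 ∷ 11 ∷ 14 ∷ []) ∷ (18 ∷ 26 ∷ 10 ∷ 3 ∷ 16 ∷ []) ∷ (21 ∷ 29 ∷ 13 ∷ 6 ∷ 19 ∷ []) ∷ (24 ∷ 17 ∷ 1 ∷ 9 ∷ 22 ∷ []) ∷ (27 ∷ 20 ∷ 4 ∷ 12 ∷ 25 ∷ []) ∷ (15 ∷ 23 ∷ 7 ∷ 0 ∷ 28 ∷ []) ∷ []) ∷
    ((15 ∷ 18 ∷ 21 ∷ 24 ∷ 27 ∷ []) ∷ (8 ∷ 12 ∷ 26 ∷ 13 ∷ 25 ∷ []) ∷ (11 ∷ 0 ∷ 29 ∷ 1 ∷ 28 ∷ []) ∷ (14 ∷ 3 ∷ 17 ∷ 4 ∷ 16 ∷ []) ∷ (2 ∷ 6 ∷ 20 ∷ 7 ∷ 19 ∷ []) ∷ (5 ∷ 9 ∷ 23 ∷ 10 ∷ 22 ∷ []) ∷ []) ∷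
    ((15 ∷ 21 ∷ 27 ∷ 18 ∷ 24 ∷ []) ∷ (13 ∷ 9 ∷ 14 ∷ 25 ∷ 17 ∷ []) ∷ (1 ∷ 12 ∷ 2 ∷ 28 ∷ 20 ∷ []) ∷ (4 ∷ 0 ∷ 5 ∷ 16 ∷ 23 ∷ []) ∷ (7 ∷ 3 ∷ 8 ∷ 19 ∷ 26 ∷ []) ∷ (10 ∷ 6 ∷ 11 ∷ 22 ∷ 29 ∷ []) ∷ []) ∷
    ((1 ∷ 7 ∷ 13 ∷ 4 ∷ 10 ∷ []) ∷ (8 ∷ 16 ∷ 27 ∷ 17 ∷ 0 ∷ []) ∷ (11 ∷ 19 ∷ 15 ∷ 20 ∷ 3 ∷ []) ∷ (14 ∷ 22 ∷ 18 ∷ 23 ∷ 6 ∷ []) ∷ (2 ∷ 25 ∷ 21 ∷ 26 ∷ 9 ∷ []) ∷ (5 ∷ 28 ∷ 24 ∷ 29 ∷ 12 ∷ []) ∷ []) ∷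
    ((16 ∷ 22 ∷ 28 ∷ 19 ∷ 25 ∷ []) ∷ (5 ∷ 18 ∷ 1 ∷ 3 ∷ 29 ∷ []) ∷ (8 ∷ 21 ∷ 4 ∷ 6 ∷ 17 ∷ []) ∷ (11 ∷ 24 ∷ 7 ∷ 9 ∷ 20 ∷ []) ∷ (14 ∷ 27 ∷ 10 ∷ 12 ∷ 23 ∷ []) ∷ (2 ∷ 15 ∷ 13 ∷ 0 ∷ 26 ∷ []) ∷ []) ∷
    ((1 ∷ 4 ∷ 7 ∷ 10 ∷ 13 ∷ []) ∷ (9 ∷ 17 ∷ 15 ∷ 11 ∷ 16 ∷ []) ∷ (12 ∷ 20 ∷ 18 ∷ 14 ∷ 19 ∷ []) ∷ (0 ∷ 23 ∷ 21 ∷ 2 ∷ 22 ∷ []) ∷ (3 ∷ 26 ∷ 24 ∷ 5 ∷ 25 ∷ []) ∷ (6 ∷ 29 ∷ 27 ∷ 8 ∷ 28 ∷ []) ∷ []) ∷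
    ((16 ∷ 19 ∷ 22 ∷ 25 ∷ 28 ∷ []) ∷ (29 ∷ 9 ∷ 21 ∷ 13 ∷ 8 ∷ []) ∷ (17 ∷ 12 ∷ 24 ∷ 1 ∷ 11 ∷ []) ∷ (20 ∷ 0 ∷ 27 ∷ 4 ∷ 14 ∷ []) ∷ (23 ∷ 3 ∷ 15 ∷ 7 ∷ 2 ∷ []) ∷ (26 ∷ 6 ∷ 18 ∷ 10 ∷ 5 ∷ []) ∷ []) ∷
    ((17 ∷ 20 ∷ 23 ∷ 26 ∷ 29 ∷ []) ∷ (5 ∷ 21 ∷ 0 ∷ 19 ∷ 13 ∷ []) ∷ (8 ∷ 24 ∷ 3 ∷ 22 ∷ 1 ∷ []) ∷ (11 ∷ 27 ∷ 6 ∷ 25 ∷ 4 ∷ []) ∷ (14 ∷ 15 ∷ 9 ∷ 28 ∷ 7 ∷ []) ∷ (2 ∷ 18 ∷ 12 ∷ 16 ∷ 10 ∷ []) ∷ []) ∷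
    ((17 ∷ 23 ∷ 29 ∷ 20 ∷ 26 ∷ []) ∷ (5 ∷ 1 ∷ 21 ∷ 3 ∷ 19 ∷ []) ∷ (8 ∷ 4 ∷ 24 ∷ 6 ∷ 22 ∷ []) ∷ (11 ∷ 7 ∷ 27 ∷ 9 ∷ 25 ∷ []) ∷ (14 ∷ 10 ∷ 15 ∷ 12 ∷ 28 ∷ []) ∷ (2 ∷ 13 ∷ 18 ∷ 0 ∷ 16 ∷ []) ∷ []) ∷
    ((0 ∷ 3 ∷ 6 ∷ 9 ∷ 12 ∷ []) ∷ (11 ∷ 23 ∷ 19 ∷ 24 ∷ 13 ∷ []) ∷ (14 ∷ 26 ∷ 22 ∷ 27 ∷ 1 ∷ []) ∷ (2 ∷ 29 ∷ 25 ∷ 15 ∷ 4 ∷ []) ∷ (5 ∷ 17 ∷ 28 ∷ 18 ∷ 7 ∷ []) ∷ (8 ∷ 20 ∷ 16 ∷ 21 ∷ 10 ∷ []) ∷ []) ∷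
    ((0 ∷ 6 ∷ 12 ∷ 3 ∷ 9 ∷ []) ∷ (2 ∷ 24 ∷ 16 ∷ 13 ∷ 20 ∷ []) ∷ (5 ∷ 27 ∷ 19 ∷ 1 ∷ 23 ∷ []) ∷ (8 ∷ 15 ∷ 22 ∷ 4 ∷ 26 ∷ []) ∷ (11 ∷ 18 ∷ 25 ∷ 7 ∷ 29 ∷ []) ∷ (14 ∷ 21 ∷ 28 ∷ 10 ∷ 17 ∷ []) ∷ []) ∷
    []
  )

hwp₃₀ 3 _ _ _ refl = hwp₃₀-from-cycles
  ( ((5 ∷ 10 ∷ 18 ∷ []) ∷ (8 ∷ 13 ∷ 21 ∷ []) ∷ (11 ∷ 1 ∷ 24 ∷ []) ∷ (14 ∷ 4 ∷ 27 ∷ []) ∷ (2 ∷ 7 ∷ 15 ∷ []) ∷ (23 ∷ 9 ∷ 16 ∷ []) ∷ (26 ∷ 12 ∷ 19 ∷ []) ∷ (29 ∷ 0 ∷ 22 ∷ []) ∷ (17 ∷ 3 ∷ 25 ∷ []) ∷ (20 ∷ 6 ∷ 28 ∷ []) ∷ []) ∷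
    ((6 ∷ 11 ∷ 19 ∷ []) ∷ (9 ∷ 14 ∷ 22 ∷ []) ∷ (12 ∷ 2 ∷ 25 ∷ []) ∷ (0 ∷ 5 ∷ 28 ∷ []) ∷ (3 ∷ 8 ∷ 16 ∷ []) ∷ (24 ∷ 10 ∷ 17 ∷ []) ∷ (27 ∷ 13 ∷ 20 ∷ []) ∷ (15 ∷ 1 ∷ 23 ∷ []) ∷ (18 ∷ 4 ∷ 26 ∷ []) ∷ (21 ∷ 7 ∷ 29 ∷ []) ∷ []) ∷
    ((7 ∷ 12 ∷ 20 ∷ []) ∷ (10 ∷ 0 ∷ 23 ∷ []) ∷ (13 ∷ 3 ∷ 26 ∷ []) ∷ (1 ∷ 6 ∷ 29 ∷ []) ∷ (4 ∷ 9 ∷ 17 ∷ []) ∷ (25 ∷ 11 ∷ 18 ∷ []) ∷ (28 ∷ 14 ∷ 21 ∷ []) ∷ (16 ∷ 2 ∷ 24 ∷ []) ∷ (19 ∷ 5 ∷ 27 ∷ []) ∷ (22 ∷ 8 ∷ 15 ∷ []) ∷ []) ∷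
    []
  )
  ( ((11 ∷ 12 ∷ 4 ∷ 15 ∷ 21 ∷ []) ∷ (1 ∷ 2 ∷ 9 ∷ 20 ∷ 26 ∷ []) ∷ (6 ∷ 7 ∷ 14 ∷ 25 ∷ 16 ∷ []) ∷ (27 ∷ 0 ∷ 3 ∷ 24 ∷ 23 ∷ []) ∷ (17 ∷ 5 ∷ 8 ∷ 29 ∷ 28 ∷ []) ∷ (22 ∷ 10 ∷ 13 ∷ 19 ∷ 18 ∷ []) ∷ []) ∷
    ((12 ∷ 13 ∷ 5 ∷ 16 ∷ 22 ∷ []) ∷ (2 ∷ 3 ∷ 10 ∷ 21 ∷ 27 ∷ []) ∷ (7 ∷ 8 ∷ 0 ∷ 26 ∷ 17 ∷ []) ∷ (28 ∷ 1 ∷ 4 ∷ 25 ∷ 24 ∷ []) ∷ (18 ∷ 6 ∷ 9 ∷ 15 ∷ 29 ∷ []) ∷ (23 ∷ 11 ∷ 14 ∷ 20 ∷ 19 ∷ []) ∷ []) ∷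
    ((13 ∷ 14 ∷ 6 ∷ 17 ∷ 23 ∷ []) ∷ (3 ∷ 4 ∷ 11 ∷ 22 ∷ 28 ∷ []) ∷ (8 ∷ 9 ∷ 1 ∷ 27 ∷ 18 ∷ []) ∷ (29 ∷ 2 ∷ 5 ∷ 26 ∷ 25 ∷ []) ∷ (19 ∷ 7 ∷ 10 ∷ 16 ∷ 15 ∷ []) ∷ (24 ∷ 12 ∷ 0 ∷ 21 ∷ 20 ∷ []) ∷ []) ∷
    ((14 ∷ 0 ∷ 7 ∷ 18 ∷ 24 ∷ []) ∷ (4 ∷ 5 ∷ 12 ∷ 23 ∷ 29 ∷ []) ∷ (9 ∷ 10 ∷ 2 ∷ 28 ∷ 19 ∷ []) ∷ (15 ∷ 3 ∷ 6 ∷ 27 ∷ 26 ∷ []) ∷ (20 ∷ 8 ∷ 11 ∷ 17 ∷ 16 ∷ []) ∷ (25 ∷ 13 ∷ 1 ∷ 22 ∷ 21 ∷ []) ∷ []) ∷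
    ((0 ∷ 1 ∷ 8 ∷ 19 ∷ 25 ∷ []) ∷ (5 ∷ 6 ∷ 13 ∷ 24 ∷ 15 ∷ []) ∷ (10 ∷ 11 ∷ 3 ∷ 29 ∷ 20 ∷ []) ∷ (16 ∷ 4 ∷ 7 ∷ 28 ∷ 27 ∷ []) ∷ (21 ∷ 9 ∷ 12 ∷ 18 ∷ 17 ∷ []) ∷ (26 ∷ 14 ∷ 2 ∷ 23 ∷ 22 ∷ []) ∷ []) ∷
    ((17 ∷ 29 ∷ 26 ∷ 23 ∷ 20 ∷ []) ∷ (22 ∷ 13 ∷ 0 ∷ 11 ∷ 27 ∷ []) ∷ (25 ∷ 1 ∷ 3 ∷ 14 ∷ 15 ∷ []) ∷ (28 ∷ 4 ∷ 6 ∷ 2 ∷ 18 ∷ []) ∷ (16 ∷ 7 ∷ 9 ∷ 5 ∷ 21 ∷ []) ∷ (19 ∷ 10 ∷ 12 ∷ 8 ∷ 24 ∷ []) ∷ []) ∷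
    ((18 ∷ 15 ∷ 27 ∷ 24 ∷ 21 ∷ []) ∷ (23 ∷ 14 ∷ 1 ∷ 12 ∷ 28 ∷ []) ∷ (26 ∷ 2 ∷ 4 ∷ 0 ∷ 16 ∷ []) ∷ (29 ∷ 5 ∷ 7 ∷ 3 ∷ 19 ∷ []) ∷ (17 ∷ 8 ∷ 10 ∷ 6 ∷ 22 ∷ []) ∷ (20 ∷ 11 ∷ 13 ∷ 9 ∷ 25 ∷ []) ∷ []) ∷
    ((19 ∷ 16 ∷ 28 ∷ 25 ∷ 22 ∷ []) ∷ (24 ∷ 0 ∷ 2 ∷ 13 ∷ 29 ∷ []) ∷ (27 ∷ 3 ∷ 5 ∷ 1 ∷ 17 ∷ []) ∷ (15 ∷ 6 ∷ 8 ∷ 4 ∷ 20 ∷ []) ∷ (18 ∷ 9 ∷ 11 ∷ 7 ∷ 23 ∷ []) ∷ (21 ∷ 12 ∷ 14 ∷ 10 ∷ 26 ∷ []) ∷ []) ∷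
    ((1 ∷ 10 ∷ 4 ∷ 13 ∷ 7 ∷ []) ∷ (27 ∷ 9 ∷ 26 ∷ 28 ∷ 8 ∷ []) ∷ (15 ∷ 12 ∷ 29 ∷ 16 ∷ 11 ∷ []) ∷ (18 ∷ 0 ∷ 17 ∷ 19 ∷ 14 ∷ []) ∷ (21 ∷ 3 ∷ 20 ∷ 22 ∷ 2 ∷ []) ∷ (24 ∷ 6 ∷ 23 ∷ 25 ∷ 5 ∷ []) ∷ []) ∷
    ((2 ∷ 11 ∷ 5 ∷ 14 ∷ 8 ∷ []) ∷ (28 ∷ 10 ∷ 27 ∷ 29 ∷ 9 ∷ []) ∷ (16 ∷ 13 ∷ 15 ∷ 17 ∷ 12 ∷ []) ∷ (19 ∷ 1 ∷ 18 ∷ 20 ∷ 0 ∷ []) ∷ (22 ∷ 4 ∷ 21 ∷ 23 ∷ 3 ∷ []) ∷ (25 ∷ 7 ∷ 24 ∷ 26 ∷ 6 ∷ []) ∷ []) ∷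
    ((3 ∷ 12 ∷ 6 ∷ 0 ∷ 9 ∷ []) ∷ (29 ∷ 11 ∷ 28 ∷ 15 ∷ 10 ∷ []) ∷ (17 ∷ 14 ∷ 16 ∷ 18 ∷ 13 ∷ []) ∷ (20 ∷ 2 ∷ 19 ∷ 21 ∷ 1 ∷ []) ∷ (23 ∷ 5 ∷ 22 ∷ 24 ∷ 4 ∷ []) ∷ (26 ∷ 8 ∷ 25 ∷ 27 ∷ 7 ∷ []) ∷ []) ∷
    []
  )

hwp₃₀ 4 _ _ _ refl = hwp₃₀-from-cycles
  ( ((0 ∷ 1 ∷ 29 ∷ []) ∷ (3 ∷ 4 ∷ 17 ∷ []) ∷ (6 ∷ 7 ∷ 20 ∷ []) ∷ (9 ∷ 10 ∷ 23 ∷ []) ∷ (12 ∷ 13 ∷ 26 ∷ []) ∷ (15 ∷ 28 ∷ 5 ∷ []) ∷ (18 ∷ 16 ∷ 8 ∷ []) ∷ (21 ∷ 19 ∷ 11 ∷ []) ∷ (24 ∷ 22 ∷ 14 ∷ []) ∷ (27 ∷ 25 ∷ 2 ∷ []) ∷ []) ∷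
    ((1 ∷ 2 ∷ 15 ∷ []) ∷ (4 ∷ 5 ∷ 18 ∷ []) ∷ (7 ∷ 8 ∷ 21 ∷ []) ∷ (10 ∷ 11 ∷ 24 ∷ []) ∷ (13 ∷ 14 ∷ 27 ∷ []) ∷ (16 ∷ 29 ∷ 6 ∷ []) ∷ (19 ∷ 17 ∷ 9 ∷ []) ∷ (22 ∷ 20 ∷ 12 ∷ []) ∷ (25 ∷ 23 ∷ 0 ∷ []) ∷ (28 ∷ 26 ∷ 3 ∷ []) ∷ []) ∷
    ((2 ∷ 3 ∷ 16 ∷ []) ∷ (5 ∷ 6 ∷ 19 ∷ []) ∷ (8 ∷ 9 ∷ 22 ∷ []) ∷ (11 ∷ 12 ∷ 25 ∷ []) ∷ (14 ∷ 0 ∷ 28 ∷ []) ∷ (17 ∷ 15 ∷ 7 ∷ []) ∷ (20 ∷ 18 ∷ 10 ∷ []) ∷ (23 ∷ 21 ∷ 13 ∷ []) ∷ (26 ∷ 24 ∷ 1 ∷ []) ∷ (29 ∷ 27 ∷ 4 ∷ []) ∷ []) ∷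
    ((0 ∷ 5 ∷ 10 ∷ []) ∷ (15 ∷ 20 ∷ 25 ∷ []) ∷ (1 ∷ 6 ∷ 11 ∷ []) ∷ (16 ∷ 21 ∷ 26 ∷ []) ∷ (2 ∷ 7 ∷ 12 ∷ []) ∷ (17 ∷ 22 ∷ 27 ∷ []) ∷ (3 ∷ 8 ∷ 13 ∷ []) ∷ (18 ∷ 23 ∷ 28 ∷ []) ∷ (4 ∷ 9 ∷ 14 ∷ []) ∷ (19 ∷ 24 ∷ 29 ∷ []) ∷ []) ∷
    []
  )
  ( ((19 ∷ 18 ∷ 2 ∷ 14 ∷ 16 ∷ []) ∷ (24 ∷ 23 ∷ 7 ∷ 4 ∷ 21 ∷ []) ∷ (29 ∷ 28 ∷ 12 ∷ 9 ∷ 26 ∷ []) ∷ (15 ∷ 22 ∷ 13 ∷ 0 ∷ 11 ∷ []) ∷ (20 ∷ 27 ∷ 3 ∷ 5 ∷ 1 ∷ []) ∷ (25 ∷ 17 ∷ 8 ∷ 10 ∷ 6 ∷ []) ∷ []) ∷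
    ((20 ∷ 19 ∷ 3 ∷ 0 ∷ 17 ∷ []) ∷ (25 ∷ 24 ∷ 8 ∷ 5 ∷ 22 ∷ []) ∷ (15 ∷ 29 ∷ 13 ∷ 10 ∷ 27 ∷ []) ∷ (16 ∷ 23 ∷ 14 ∷ 1 ∷ 12 ∷ []) ∷ (21 ∷ 28 ∷ 4 ∷ 6 ∷ 2 ∷ []) ∷ (26 ∷ 18 ∷ 9 ∷ 11 ∷ 7 ∷ []) ∷ []) ∷
    ((21 ∷ 20 ∷ 4 ∷ 1 ∷ 18 ∷ []) ∷ (26 ∷ 25 ∷ 9 ∷ 6 ∷ 23 ∷ []) ∷ (16 ∷ 15 ∷ 14 ∷ 11 ∷ 28 ∷ []) ∷ (17 ∷ 24 ∷ 0 ∷ 2 ∷ 13 ∷ []) ∷ (22 ∷ 29 ∷ 5 ∷ 7 ∷ 3 ∷ []) ∷ (27 ∷ 19 ∷ 10 ∷ 12 ∷ 8 ∷ []) ∷ []) ∷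
    ((22 ∷ 21 ∷ 5 ∷ 2 ∷ 19 ∷ []) ∷ (27 ∷ 26 ∷ 10 ∷ 7 ∷ 24 ∷ []) ∷ (17 ∷ 16 ∷ 0 ∷ 12 ∷ 29 ∷ []) ∷ (18 ∷ 25 ∷ 1 ∷ 3 ∷ 14 ∷ []) ∷ (23 ∷ 15 ∷ 6 ∷ 8 ∷ 4 ∷ []) ∷ (28 ∷ 20 ∷ 11 ∷ 13 ∷ 9 ∷ []) ∷ []) ∷
    ((23 ∷ 22 ∷ 6 ∷ 3 ∷ 20 ∷ []) ∷ (28 ∷ 27 ∷ 11 ∷ 8 ∷ 25 ∷ []) ∷ (18 ∷ 17 ∷ 1 ∷ 13 ∷ 15 ∷ []) ∷ (19 ∷ 26 ∷ 2 ∷ 4 ∷ 0 ∷ []) ∷ (24 ∷ 16 ∷ 7 ∷ 9 ∷ 5 ∷ []) ∷ (29 ∷ 21 ∷ 12 ∷ 14 ∷ 10 ∷ []) ∷ []) ∷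
    ((22 ∷ 26 ∷ 14 ∷ 7 ∷ 28 ∷ []) ∷ (27 ∷ 16 ∷ 4 ∷ 12 ∷ 18 ∷ []) ∷ (17 ∷ 21 ∷ 9 ∷ 2 ∷ 23 ∷ []) ∷ (24 ∷ 13 ∷ 20 ∷ 0 ∷ 6 ∷ []) ∷ (29 ∷ 3 ∷ 25 ∷ 5 ∷ 11 ∷ []) ∷ (19 ∷ 8 ∷ 15 ∷ 10 ∷ 1 ∷ []) ∷ []) ∷
    ((23 ∷ 27 ∷ 0 ∷ 8 ∷ 29 ∷ []) ∷ (28 ∷ 17 ∷ 5 ∷ 13 ∷ 19 ∷ []) ∷ (18 ∷ 22 ∷ 10 ∷ 3 ∷ 24 ∷ []) ∷ (25 ∷ 14 ∷ 21 ∷ 1 ∷ 7 ∷ []) ∷ (15 ∷ 4 ∷ 26 ∷ 6 ∷ 12 ∷ []) ∷ (20 ∷ 9 ∷ 16 ∷ 11 ∷ 2 ∷ []) ∷ []) ∷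
    ((24 ∷ 28 ∷ 1 ∷ 9 ∷ 15 ∷ []) ∷ (29 ∷ 18 ∷ 6 ∷ 14 ∷ 20 ∷ []) ∷ (19 ∷ 23 ∷ 11 ∷ 4 ∷ 25 ∷ []) ∷ (26 ∷ 0 ∷ 22 ∷ 2 ∷ 8 ∷ []) ∷ (16 ∷ 5 ∷ 27 ∷ 7 ∷ 13 ∷ []) ∷ (21 ∷ 10 ∷ 17 ∷ 12 ∷ 3 ∷ []) ∷ []) ∷
    ((25 ∷ 29 ∷ 2 ∷ 10 ∷ 16 ∷ []) ∷ (15 ∷ 19 ∷ 7 ∷ 0 ∷ 21 ∷ []) ∷ (20 ∷ 24 ∷ 12 ∷ 5 ∷ 26 ∷ []) ∷ (27 ∷ 1 ∷ 23 ∷ 3 ∷ 9 ∷ []) ∷ (17 ∷ 6 ∷ 28 ∷ 8 ∷ 14 ∷ []) ∷ (22 ∷ 11 ∷ 18 ∷ 13 ∷ 4 ∷ []) ∷ []) ∷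
    ((26 ∷ 15 ∷ 3 ∷ 11 ∷ 17 ∷ []) ∷ (16 ∷ 20 ∷ 8 ∷ 1 ∷ 22 ∷ []) ∷ (21 ∷ 25 ∷ 13 ∷ 6 ∷ 27 ∷ []) ∷ (28 ∷ 2 ∷ 24 ∷ 4 ∷ 10 ∷ []) ∷ (18 ∷ 7 ∷ 29 ∷ 9 ∷ 0 ∷ []) ∷ (23 ∷ 12 ∷ 19 ∷ 14 ∷ 5 ∷ []) ∷ []) ∷
    []
  )

hwp₃₀ 5 _ _ _ refl = hwp₃₀-from-cycles
  ( ((0 ∷ 10 ∷ 5 ∷ []) ∷ (20 ∷ 2 ∷ 23 ∷ []) ∷ (25 ∷ 7 ∷ 28 ∷ []) ∷ (15 ∷ 12 ∷ 18 ∷ []) ∷ (1 ∷ 8 ∷ 27 ∷ []) ∷ (6 ∷ 13 ∷ 17 ∷ []) ∷ (11 ∷ 3 ∷ 22 ∷ []) ∷ (29 ∷ 9 ∷ 16 ∷ []) ∷ (19 ∷ 14 ∷ 21 ∷ []) ∷ (24 ∷ 4 ∷ 26 ∷ []) ∷ []) ∷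
    ((1 ∷ 11 ∷ 6 ∷ []) ∷ (21 ∷ 3 ∷ 24 ∷ []) ∷ (26 ∷ 8 ∷ 29 ∷ []) ∷ (16 ∷ 13 ∷ 19 ∷ []) ∷ (2 ∷ 9 ∷ 28 ∷ []) ∷ (7 ∷ 14 ∷ 18 ∷ []) ∷ (12 ∷ 4 ∷ 23 ∷ []) ∷ (15 ∷ 10 ∷ 17 ∷ []) ∷ (20 ∷ 0 ∷ 22 ∷ []) ∷ (25 ∷ 5 ∷ 27 ∷ []) ∷ []) ∷
    ((2 ∷ 12 ∷ 7 ∷ []) ∷ (22 ∷ 4 ∷ 25 ∷ []) ∷ (27 ∷ 9 ∷ 15 ∷ []) ∷ (17 ∷ 14 ∷ 20 ∷ []) ∷ (3 ∷ 10 ∷ 29 ∷ []) ∷ (8 ∷ 0 ∷ 19 ∷ []) ∷ (13 ∷ 5 ∷ 24 ∷ []) ∷ (16 ∷ 11 ∷ 18 ∷ []) ∷ (21 ∷ 1 ∷ 23 ∷ []) ∷ (26 ∷ 6 ∷ 28 ∷ []) ∷ []) ∷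
    ((3 ∷ 13 ∷ 8 ∷ []) ∷ (23 ∷ 5 ∷ 26 ∷ []) ∷ (28 ∷ 10 ∷ 16 ∷ []) ∷ (18 ∷ 0 ∷ 21 ∷ []) ∷ (4 ∷ 11 ∷ 15 ∷ []) ∷ (9 ∷ 1 ∷ 20 ∷ []) ∷ (14 ∷ 6 ∷ 25 ∷ []) ∷ (17 ∷ 12 ∷ 19 ∷ []) ∷ (22 ∷ 2 ∷ 24 ∷ []) ∷ (27 ∷ 7 ∷ 29 ∷ []) ∷ []) ∷
    ((4 ∷ 14 ∷ 9 ∷ []) ∷ (24 ∷ 6 ∷ 27 ∷ []) ∷ (29 ∷ 11 ∷ 17 ∷ []) ∷ (19 ∷ 1 ∷ 22 ∷ []) ∷ (5 ∷ 12 ∷ 16 ∷ []) ∷ (10 ∷ 2 ∷ 21 ∷ []) ∷ (0 ∷ 7 ∷ 26 ∷ []) ∷ (18 ∷ 13 ∷ 20 ∷ []) ∷ (23 ∷ 3 ∷ 25 ∷ []) ∷ (28 ∷ 8 ∷ 15 ∷ []) ∷ []) ∷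
    []
  )
  ( ((17 ∷ 23 ∷ 29 ∷ 20 ∷ 26 ∷ []) ∷ (9 ∷ 8 ∷ 18 ∷ 10 ∷ 22 ∷ []) ∷ (12 ∷ 11 ∷ 21 ∷ 13 ∷ 25 ∷ []) ∷ (0 ∷ 14 ∷ 24 ∷ 1 ∷ 28 ∷ []) ∷ (3 ∷ 2 ∷ 27 ∷ 4 ∷ 16 ∷ []) ∷ (6 ∷ 5 ∷ 15 ∷ 7 ∷ 19 ∷ []) ∷ []) ∷
    ((18 ∷ 24 ∷ 15 ∷ 21 ∷ 27 ∷ []) ∷ (10 ∷ 9 ∷ 19 ∷ 11 ∷ 23 ∷ []) ∷ (13 ∷ 12 ∷ 22 ∷ 14 ∷ 26 ∷ []) ∷ (1 ∷ 0 ∷ 25 ∷ 2 ∷ 29 ∷ []) ∷ (4 ∷ 3 ∷ 28 ∷ 5 ∷ 17 ∷ []) ∷ (7 ∷ 6 ∷ 16 ∷ 8 ∷ 20 ∷ []) ∷ []) ∷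
    ((19 ∷ 25 ∷ 16 ∷ 22 ∷ 28 ∷ []) ∷ (11 ∷ 10 ∷ 20 ∷ 12 ∷ 24 ∷ []) ∷ (14 ∷ 13 ∷ 23 ∷ 0 ∷ 27 ∷ []) ∷ (2 ∷ 1 ∷ 26 ∷ 3 ∷ 15 ∷ []) ∷ (5 ∷ 4 ∷ 29 ∷ 6 ∷ 18 ∷ []) ∷ (8 ∷ 7 ∷ 17 ∷ 9 ∷ 21 ∷ []) ∷ []) ∷
    ((0 ∷ 6 ∷ 12 ∷ 3 ∷ 9 ∷ []) ∷ (28 ∷ 14 ∷ 1 ∷ 17 ∷ 27 ∷ []) ∷ (16 ∷ 2 ∷ 4 ∷ 20 ∷ 15 ∷ []) ∷ (19 ∷ 5 ∷ 7 ∷ 23 ∷ 18 ∷ []) ∷ (22 ∷ 8 ∷ 10 ∷ 26 ∷ 21 ∷ []) ∷ (25 ∷ 11 ∷ 13 ∷ 29 ∷ 24 ∷ []) ∷ []) ∷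
    ((1 ∷ 7 ∷ 13 ∷ 4 ∷ 10 ∷ []) ∷ (29 ∷ 0 ∷ 2 ∷ 18 ∷ 28 ∷ []) ∷ (17 ∷ 3 ∷ 5 ∷ 21 ∷ 16 ∷ []) ∷ (20 ∷ 6 ∷ 8 ∷ 24 ∷ 19 ∷ []) ∷ (23 ∷ 9 ∷ 11 ∷ 27 ∷ 22 ∷ []) ∷ (26 ∷ 12 ∷ 14 ∷ 15 ∷ 25 ∷ []) ∷ []) ∷
    ((2 ∷ 8 ∷ 14 ∷ 5 ∷ 11 ∷ []) ∷ (15 ∷ 1 ∷ 3 ∷ 19 ∷ 29 ∷ []) ∷ (18 ∷ 4 ∷ 6 ∷ 22 ∷ 17 ∷ []) ∷ (21 ∷ 7 ∷ 9 ∷ 25 ∷ 20 ∷ []) ∷ (24 ∷ 10 ∷ 12 ∷ 28 ∷ 23 ∷ []) ∷ (27 ∷ 13 ∷ 0 ∷ 16 ∷ 26 ∷ []) ∷ []) ∷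
    ((2 ∷ 5 ∷ 8 ∷ 11 ∷ 14 ∷ []) ∷ (23 ∷ 6 ∷ 10 ∷ 19 ∷ 27 ∷ []) ∷ (26 ∷ 9 ∷ 13 ∷ 22 ∷ 15 ∷ []) ∷ (29 ∷ 12 ∷ 1 ∷ 25 ∷ 18 ∷ []) ∷ (17 ∷ 0 ∷ 4 ∷ 28 ∷ 21 ∷ []) ∷ (20 ∷ 3 ∷ 7 ∷ 16 ∷ 24 ∷ []) ∷ []) ∷
    ((3 ∷ 6 ∷ 9 ∷ 12 ∷ 0 ∷ []) ∷ (24 ∷ 7 ∷ 11 ∷ 20 ∷ 28 ∷ []) ∷ (27 ∷ 10 ∷ 14 ∷ 23 ∷ 16 ∷ []) ∷ (15 ∷ 13 ∷ 2 ∷ 26 ∷ 19 ∷ []) ∷ (18 ∷ 1 ∷ 5 ∷ 29 ∷ 22 ∷ []) ∷ (21 ∷ 4 ∷ 8 ∷ 17 ∷ 25 ∷ []) ∷ []) ∷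
    ((4 ∷ 7 ∷ 10 ∷ 13 ∷ 1 ∷ []) ∷ (25 ∷ 8 ∷ 12 ∷ 21 ∷ 29 ∷ []) ∷ (28 ∷ 11 ∷ 0 ∷ 24 ∷ 17 ∷ []) ∷ (16 ∷ 14 ∷ 3 ∷ 27 ∷ 20 ∷ []) ∷ (19 ∷ 2 ∷ 6 ∷ 15 ∷ 23 ∷ []) ∷ (22 ∷ 5 ∷ 9 ∷ 18 ∷ 26 ∷ []) ∷ []) ∷
    []
  )

hwp₃₀ 6 _ _ _ refl = hwp₃₀-from-cycles
  ( ((5 ∷ 7 ∷ 19 ∷ []) ∷ (8 ∷ 10 ∷ 22 ∷ []) ∷ (11 ∷ 13 ∷ 25 ∷ []) ∷ (14 ∷ 1 ∷ 28 ∷ []) ∷ (2 ∷ 4 ∷ 16 ∷ []) ∷ (3 ∷ 20 ∷ 21 ∷ []) ∷ (6 ∷ 23 ∷ 24 ∷ []) ∷ (9 ∷ 26 ∷ 27 ∷ []) ∷ (12 ∷ 29 ∷ 15 ∷ []) ∷ (0 ∷ 17 ∷ 18 ∷ []) ∷ []) ∷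
    ((6 ∷ 8 ∷ 20 ∷ []) ∷ (9 ∷ 11 ∷ 23 ∷ []) ∷ (12 ∷ 14 ∷ 26 ∷ []) ∷ (0 ∷ 2 ∷ 29 ∷ []) ∷ (3 ∷ 5 ∷ 17 ∷ []) ∷ (4 ∷ 21 ∷ 22 ∷ []) ∷ (7 ∷ 24 ∷ 25 ∷ []) ∷ (10 ∷ 27 ∷ 28 ∷ []) ∷ (13 ∷ 15 ∷ 16 ∷ []) ∷ (1 ∷ 18 ∷ 19 ∷ []) ∷ []) ∷
    ((7 ∷ 9 ∷ 21 ∷ []) ∷ (10 ∷ 12 ∷ 24 ∷ []) ∷ (13 ∷ 0 ∷ 27 ∷ []) ∷ (1 ∷ 3 ∷ 15 ∷ []) ∷ (4 ∷ 6 ∷ 18 ∷ []) ∷ (5 ∷ 22 ∷ 23 ∷ []) ∷ (8 ∷ 25 ∷ 26 ∷ []) ∷ (11 ∷ 28 ∷ 29 ∷ []) ∷ (14 ∷ 16 ∷ 17 ∷ []) ∷ (2 ∷ 19 ∷ 20 ∷ []) ∷ []) ∷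
    ((8 ∷ 19 ∷ 0 ∷ []) ∷ (11 ∷ 22 ∷ 3 ∷ []) ∷ (14 ∷ 25 ∷ 6 ∷ []) ∷ (2 ∷ 28 ∷ 9 ∷ []) ∷ (5 ∷ 16 ∷ 12 ∷ []) ∷ (15 ∷ 20 ∷ 7 ∷ []) ∷ (18 ∷ 23 ∷ 10 ∷ []) ∷ (21 ∷ 26 ∷ 13 ∷ []) ∷ (24 ∷ 29 ∷ 1 ∷ []) ∷ (27 ∷ 17 ∷ 4 ∷ []) ∷ []) ∷
    ((9 ∷ 20 ∷ 1 ∷ []) ∷ (12 ∷ 23 ∷ 4 ∷ []) ∷ (0 ∷ 26 ∷ 7 ∷ []) ∷ (3 ∷ 29 ∷ 10 ∷ []) ∷ (6 ∷ 17 ∷ 13 ∷ []) ∷ (16 ∷ 21 ∷ 8 ∷ []) ∷ (19 ∷ 24 ∷ 11 ∷ []) ∷ (22 ∷ 27 ∷ 14 ∷ []) ∷ (25 ∷ 15 ∷ 2 ∷ []) ∷ (28 ∷ 18 ∷ 5 ∷ []) ∷ []) ∷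
    ((10 ∷ 21 ∷ 2 ∷ []) ∷ (13 ∷ 24 ∷ 5 ∷ []) ∷ (1 ∷ 27 ∷ 8 ∷ []) ∷ (4 ∷ 15 ∷ 11 ∷ []) ∷ (7 ∷ 18 ∷ 14 ∷ []) ∷ (17 ∷ 22 ∷ 9 ∷ []) ∷ (20 ∷ 25 ∷ 12 ∷ []) ∷ (23 ∷ 28 ∷ 0 ∷ []) ∷ (26 ∷ 16 ∷ 3 ∷ []) ∷ (29 ∷ 19 ∷ 6 ∷ []) ∷ []) ∷
    []
  )
  ( ((15 ∷ 18 ∷ 9 ∷ 19 ∷ 26 ∷ []) ∷ (20 ∷ 23 ∷ 14 ∷ 24 ∷ 16 ∷ []) ∷ (25 ∷ 28 ∷ 4 ∷ 29 ∷ 21 ∷ []) ∷ (8 ∷ 7 ∷ 27 ∷ 11 ∷ 5 ∷ []) ∷ (13 ∷ 12 ∷ 17 ∷ 1 ∷ 10 ∷ []) ∷ (3 ∷ 2 ∷ 22 ∷ 6 ∷ 0 ∷ []) ∷ []) ∷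
    ((16 ∷ 19 ∷ 10 ∷ 20 ∷ 27 ∷ []) ∷ (21 ∷ 24 ∷ 0 ∷ 25 ∷ 17 ∷ []) ∷ (26 ∷ 29 ∷ 5 ∷ 15 ∷ 22 ∷ []) ∷ (9 ∷ 8 ∷ 28 ∷ 12 ∷ 6 ∷ []) ∷ (14 ∷ 13 ∷ 18 ∷ 2 ∷ 11 ∷ []) ∷ (4 ∷ 3 ∷ 23 ∷ 7 ∷ 1 ∷ []) ∷ []) ∷
    ((17 ∷ 20 ∷ 11 ∷ 21 ∷ 28 ∷ []) ∷ (22 ∷ 25 ∷ 1 ∷ 26 ∷ 18 ∷ []) ∷ (27 ∷ 15 ∷ 6 ∷ 16 ∷ 23 ∷ []) ∷ (10 ∷ 9 ∷ 29 ∷ 13 ∷ 7 ∷ []) ∷ (0 ∷ 14 ∷ 19 ∷ 3 ∷ 12 ∷ []) ∷ (5 ∷ 4 ∷ 24 ∷ 8 ∷ 2 ∷ []) ∷ []) ∷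
    ((18 ∷ 21 ∷ 12 ∷ 22 ∷ 29 ∷ []) ∷ (23 ∷ 26 ∷ 2 ∷ 27 ∷ 19 ∷ []) ∷ (28 ∷ 16 ∷ 7 ∷ 17 ∷ 24 ∷ []) ∷ (11 ∷ 10 ∷ 15 ∷ 14 ∷ 8 ∷ []) ∷ (1 ∷ 0 ∷ 20 ∷ 4 ∷ 13 ∷ []) ∷ (6 ∷ 5 ∷ 25 ∷ 9 ∷ 3 ∷ []) ∷ []) ∷
    ((19 ∷ 22 ∷ 13 ∷ 23 ∷ 15 ∷ []) ∷ (24 ∷ 27 ∷ 3 ∷ 28 ∷ 20 ∷ []) ∷ (29 ∷ 17 ∷ 8 ∷ 18 ∷ 25 ∷ []) ∷ (12 ∷ 11 ∷ 16 ∷ 0 ∷ 9 ∷ []) ∷ (2 ∷ 1 ∷ 21 ∷ 5 ∷ 14 ∷ []) ∷ (7 ∷ 6 ∷ 26 ∷ 10 ∷ 4 ∷ []) ∷ []) ∷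
    ((15 ∷ 24 ∷ 18 ∷ 27 ∷ 21 ∷ []) ∷ (6 ∷ 10 ∷ 5 ∷ 26 ∷ 28 ∷ []) ∷ (9 ∷ 13 ∷ 8 ∷ 29 ∷ 16 ∷ []) ∷ (12 ∷ 1 ∷ 11 ∷ 17 ∷ 19 ∷ []) ∷ (0 ∷ 4 ∷ 14 ∷ 20 ∷ 22 ∷ []) ∷ (3 ∷ 7 ∷ 2 ∷ 23 ∷ 25 ∷ []) ∷ []) ∷
    ((16 ∷ 25 ∷ 19 ∷ 28 ∷ 22 ∷ []) ∷ (7 ∷ 11 ∷ 6 ∷ 27 ∷ 29 ∷ []) ∷ (10 ∷ 14 ∷ 9 ∷ 15 ∷ 17 ∷ []) ∷ (13 ∷ 2 ∷ 12 ∷ 18 ∷ 20 ∷ []) ∷ (1 ∷ 5 ∷ 0 ∷ 21 ∷ 23 ∷ []) ∷ (4 ∷ 8 ∷ 3 ∷ 24 ∷ 26 ∷ []) ∷ []) ∷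
    ((17 ∷ 26 ∷ 20 ∷ 29 ∷ 23 ∷ []) ∷ (8 ∷ 12 ∷ 7 ∷ 28 ∷ 15 ∷ []) ∷ (11 ∷ 0 ∷ 10 ∷ 16 ∷ 18 ∷ []) ∷ (14 ∷ 3 ∷ 13 ∷ 19 ∷ 21 ∷ []) ∷ (2 ∷ 6 ∷ 1 ∷ 22 ∷ 24 ∷ []) ∷ (5 ∷ 9 ∷ 4 ∷ 25 ∷ 27 ∷ []) ∷ []) ∷
    []
  )

hwp₃₀ 7 _ _ _ refl = hwp₃₀-from-cycles
  ( ((2 ∷ 28 ∷ 4 ∷ []) ∷ (5 ∷ 16 ∷ 7 ∷ []) ∷ (8 ∷ 19 ∷ 10 ∷ []) ∷ (11 ∷ 22 ∷ 13 ∷ []) ∷ (14 ∷ 25 ∷ 1 ∷ []) ∷ (24 ∷ 20 ∷ 6 ∷ []) ∷ (27 ∷ 23 ∷ 9 ∷ []) ∷ (15 ∷ 26 ∷ 12 ∷ []) ∷ (18 ∷ 29 ∷ 0 ∷ []) ∷ (21 ∷ 17 ∷ 3 ∷ []) ∷ []) ∷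
    ((3 ∷ 29 ∷ 5 ∷ []) ∷ (6 ∷ 17 ∷ 8 ∷ []) ∷ (9 ∷ 20 ∷ 11 ∷ []) ∷ (12 ∷ 23 ∷ 14 ∷ []) ∷ (0 ∷ 26 ∷ 2 ∷ []) ∷ (25 ∷ 21 ∷ 7 ∷ []) ∷ (28 ∷ 24 ∷ 10 ∷ []) ∷ (16 ∷ 27 ∷ 13 ∷ []) ∷ (19 ∷ 15 ∷ 1 ∷ []) ∷ (22 ∷ 18 ∷ 4 ∷ []) ∷ []) ∷
    ((4 ∷ 15 ∷ 6 ∷ []) ∷ (7 ∷ 18 ∷ 9 ∷ []) ∷ (10 ∷ 21 ∷ 12 ∷ []) ∷ (13 ∷ 24 ∷ 0 ∷ []) ∷ (1 ∷ 27 ∷ 3 ∷ []) ∷ (26 ∷ 22 ∷ 8 ∷ []) ∷ (29 ∷ 25 ∷ 11 ∷ []) ∷ (17 ∷ 28 ∷ 14 ∷ []) ∷ (20 ∷ 16 ∷ 2 ∷ []) ∷ (23 ∷ 19 ∷ 5 ∷ []) ∷ []) ∷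
    ((0 ∷ 5 ∷ 10 ∷ []) ∷ (15 ∷ 20 ∷ 25 ∷ []) ∷ (1 ∷ 6 ∷ 11 ∷ []) ∷ (16 ∷ 21 ∷ 26 ∷ []) ∷ (2 ∷ 7 ∷ 12 ∷ []) ∷ (17 ∷ 22 ∷ 27 ∷ []) ∷ (3 ∷ 8 ∷ 13 ∷ []) ∷ (18 ∷ 23 ∷ 28 ∷ []) ∷ (4 ∷ 9 ∷ 14 ∷ []) ∷ (19 ∷ 24 ∷ 29 ∷ []) ∷ []) ∷
    ((23 ∷ 21 ∷ 11 ∷ []) ∷ (26 ∷ 24 ∷ 14 ∷ []) ∷ (29 ∷ 27 ∷ 2 ∷ []) ∷ (17 ∷ 15 ∷ 5 ∷ []) ∷ (20 ∷ 18 ∷ 8 ∷ []) ∷ (4 ∷ 12 ∷ 25 ∷ []) ∷ (7 ∷ 0 ∷ 28 ∷ []) ∷ (10 ∷ 3 ∷ 16 ∷ []) ∷ (13 ∷ 6 ∷ 19 ∷ []) ∷ (1 ∷ 9 ∷ 22 ∷ []) ∷ []) ∷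
    ((24 ∷ 22 ∷ 12 ∷ []) ∷ (27 ∷ 25 ∷ 0 ∷ []) ∷ (15 ∷ 28 ∷ 3 ∷ []) ∷ (18 ∷ 16 ∷ 6 ∷ []) ∷ (21 ∷ 19 ∷ 9 ∷ []) ∷ (5 ∷ 13 ∷ 26 ∷ []) ∷ (8 ∷ 1 ∷ 29 ∷ []) ∷ (11 ∷ 4 ∷ 17 ∷ []) ∷ (14 ∷ 7 ∷ 20 ∷ []) ∷ (2 ∷ 10 ∷ 23 ∷ []) ∷ []) ∷
    ((25 ∷ 23 ∷ 13 ∷ []) ∷ (28 ∷ 26 ∷ 1 ∷ []) ∷ (16 ∷ 29 ∷ 4 ∷ []) ∷ (19 ∷ 17 ∷ 7 ∷ []) ∷ (22 ∷ 20 ∷ 10 ∷ []) ∷ (6 ∷ 14 ∷ 27 ∷ []) ∷ (9 ∷ 2 ∷ 15 ∷ []) ∷ (12 ∷ 5 ∷ 18 ∷ []) ∷ (0 ∷ 8 ∷ 21 ∷ []) ∷ (3 ∷ 11 ∷ 24 ∷ []) ∷ []) ∷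
    []
  )
  ( ((15 ∷ 21 ∷ 27 ∷ 18 ∷ 24 ∷ []) ∷ (10 ∷ 17 ∷ 9 ∷ 28 ∷ 11 ∷ []) ∷ (13 ∷ 20 ∷ 12 ∷ 16 ∷ 14 ∷ []) ∷ (1 ∷ 23 ∷ 0 ∷ 19 ∷ 2 ∷ []) ∷ (4 ∷ 26 ∷ 3 ∷ 22 ∷ 5 ∷ []) ∷ (7 ∷ 29 ∷ 6 ∷ 25 ∷ 8 ∷ []) ∷ []) ∷
    ((16 ∷ 22 ∷ 28 ∷ 19 ∷ 25 ∷ []) ∷ (11 ∷ 18 ∷ 10 ∷ 29 ∷ 12 ∷ []) ∷ (14 ∷ 21 ∷ 13 ∷ 17 ∷ 0 ∷ []) ∷ (2 ∷ 24 ∷ 1 ∷ 20 ∷ 3 ∷ []) ∷ (5 ∷ 27 ∷ 4 ∷ 23 ∷ 6 ∷ []) ∷ (8 ∷ 15 ∷ 7 ∷ 26 ∷ 9 ∷ []) ∷ []) ∷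
    ((17 ∷ 23 ∷ 29 ∷ 20 ∷ 26 ∷ []) ∷ (12 ∷ 19 ∷ 11 ∷ 15 ∷ 13 ∷ []) ∷ (0 ∷ 22 ∷ 14 ∷ 18 ∷ 1 ∷ []) ∷ (3 ∷ 25 ∷ 2 ∷ 21 ∷ 4 ∷ []) ∷ (6 ∷ 28 ∷ 5 ∷ 24 ∷ 7 ∷ []) ∷ (9 ∷ 16 ∷ 8 ∷ 27 ∷ 10 ∷ []) ∷ []) ∷
    ((0 ∷ 3 ∷ 6 ∷ 9 ∷ 12 ∷ []) ∷ (1 ∷ 4 ∷ 7 ∷ 10 ∷ 13 ∷ []) ∷ (2 ∷ 5 ∷ 8 ∷ 11 ∷ 14 ∷ []) ∷ (15 ∷ 18 ∷ 21 ∷ 24 ∷ 27 ∷ []) ∷ (16 ∷ 19 ∷ 22 ∷ 25 ∷ 28 ∷ []) ∷ (17 ∷ 20 ∷ 23 ∷ 26 ∷ 29 ∷ []) ∷ []) ∷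
    ((0 ∷ 9 ∷ 3 ∷ 12 ∷ 6 ∷ []) ∷ (4 ∷ 8 ∷ 28 ∷ 21 ∷ 20 ∷ []) ∷ (7 ∷ 11 ∷ 16 ∷ 24 ∷ 23 ∷ []) ∷ (10 ∷ 14 ∷ 19 ∷ 27 ∷ 26 ∷ []) ∷ (13 ∷ 2 ∷ 22 ∷ 15 ∷ 29 ∷ []) ∷ (1 ∷ 5 ∷ 25 ∷ 18 ∷ 17 ∷ []) ∷ []) ∷
    ((1 ∷ 10 ∷ 4 ∷ 13 ∷ 7 ∷ []) ∷ (5 ∷ 9 ∷ 29 ∷ 22 ∷ 21 ∷ []) ∷ (8 ∷ 12 ∷ 17 ∷ 25 ∷ 24 ∷ []) ∷ (11 ∷ 0 ∷ 20 ∷ 28 ∷ 27 ∷ []) ∷ (14 ∷ 3 ∷ 23 ∷ 16 ∷ 15 ∷ []) ∷ (2 ∷ 6 ∷ 26 ∷ 19 ∷ 18 ∷ []) ∷ []) ∷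
    ((2 ∷ 11 ∷ 5 ∷ 14 ∷ 8 ∷ []) ∷ (6 ∷ 10 ∷ 15 ∷ 23 ∷ 22 ∷ []) ∷ (9 ∷ 13 ∷ 18 ∷ 26 ∷ 25 ∷ []) ∷ (12 ∷ 1 ∷ 21 ∷ 29 ∷ 28 ∷ []) ∷ (0 ∷ 4 ∷ 24 ∷ 17 ∷ 16 ∷ []) ∷ (3 ∷ 7 ∷ 27 ∷ 20 ∷ 19 ∷ []) ∷ []) ∷
    []
  )

hwp₃₀ 8 _ _ _ refl = hwp₃₀-from-cycles
  ( ((2 ∷ 7 ∷ 12 ∷ []) ∷ (21 ∷ 20 ∷ 23 ∷ []) ∷ (26 ∷ 25 ∷ 28 ∷ []) ∷ (16 ∷ 15 ∷ 18 ∷ []) ∷ (17 ∷ 11 ∷ 0 ∷ []) ∷ (22 ∷ 1 ∷ 5 ∷ []) ∷ (27 ∷ 6 ∷ 10 ∷ []) ∷ (14 ∷ 13 ∷ 24 ∷ []) ∷ (4 ∷ 3 ∷ 29 ∷ []) ∷ (9 ∷ 8 ∷ 19 ∷ []) ∷ []) ∷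
    ((3 ∷ 8 ∷ 13 ∷ []) ∷ (22 ∷ 21 ∷ 24 ∷ []) ∷ (27 ∷ 26 ∷ 29 ∷ []) ∷ (17 ∷ 16 ∷ 19 ∷ []) ∷ (18 ∷ 12 ∷ 1 ∷ []) ∷ (23 ∷ 2 ∷ 6 ∷ []) ∷ (28 ∷ 7 ∷ 11 ∷ []) ∷ (0 ∷ 14 ∷ 25 ∷ []) ∷ (5 ∷ 4 ∷ 15 ∷ []) ∷ (10 ∷ 9 ∷ 20 ∷ []) ∷ []) ∷
    ((4 ∷ 9 ∷ 14 ∷ []) ∷ (23 ∷ 22 ∷ 25 ∷ []) ∷ (28 ∷ 27 ∷ 15 ∷ []) ∷ (18 ∷ 17 ∷ 20 ∷ []) ∷ (19 ∷ 13 ∷ 2 ∷ []) ∷ (24 ∷ 3 ∷ 7 ∷ []) ∷ (29 ∷ 8 ∷ 12 ∷ []) ∷ (1 ∷ 0 ∷ 26 ∷ []) ∷ (6 ∷ 5 ∷ 16 ∷ []) ∷ (11 ∷ 10 ∷ 21 ∷ []) ∷ []) ∷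
    ((5 ∷ 10 ∷ 0 ∷ []) ∷ (24 ∷ 23 ∷ 26 ∷ []) ∷ (29 ∷ 28 ∷ 16 ∷ []) ∷ (19 ∷ 18 ∷ 21 ∷ []) ∷ (20 ∷ 14 ∷ 3 ∷ []) ∷ (25 ∷ 4 ∷ 8 ∷ []) ∷ (15 ∷ 9 ∷ 13 ∷ []) ∷ (2 ∷ 1 ∷ 27 ∷ []) ∷ (7 ∷ 6 ∷ 17 ∷ []) ∷ (12 ∷ 11 ∷ 22 ∷ []) ∷ []) ∷
    ((6 ∷ 11 ∷ 1 ∷ []) ∷ (25 ∷ 24 ∷ 27 ∷ []) ∷ (15 ∷ 29 ∷ 17 ∷ []) ∷ (20 ∷ 19 ∷ 22 ∷ []) ∷ (21 ∷ 0 ∷ 4 ∷ []) ∷ (26 ∷ 5 ∷ 9 ∷ []) ∷ (16 ∷ 10 ∷ 14 ∷ []) ∷ (3 ∷ 2 ∷ 28 ∷ []) ∷ (8 ∷ 7 ∷ 18 ∷ []) ∷ (13 ∷ 12 ∷ 23 ∷ []) ∷ []) ∷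
    ((12 ∷ 10 ∷ 17 ∷ []) ∷ (0 ∷ 13 ∷ 20 ∷ []) ∷ (3 ∷ 1 ∷ 23 ∷ []) ∷ (6 ∷ 4 ∷ 26 ∷ []) ∷ (9 ∷ 7 ∷ 29 ∷ []) ∷ (24 ∷ 5 ∷ 19 ∷ []) ∷ (27 ∷ 8 ∷ 22 ∷ []) ∷ (15 ∷ 11 ∷ 25 ∷ []) ∷ (18 ∷ 14 ∷ 28 ∷ []) ∷ (21 ∷ 2 ∷ 16 ∷ []) ∷ []) ∷
    ((13 ∷ 11 ∷ 18 ∷ []) ∷ (1 ∷ 14 ∷ 21 ∷ []) ∷ (4 ∷ 2 ∷ 24 ∷ []) ∷ (7 ∷ 5 ∷ 27 ∷ []) ∷ (10 ∷ 8 ∷ 15 ∷ []) ∷ (25 ∷ 6 ∷ 20 ∷ []) ∷ (28 ∷ 9 ∷ 23 ∷ []) ∷ (16 ∷ 12 ∷ 26 ∷ []) ∷ (19 ∷ 0 ∷ 29 ∷ []) ∷ (22 ∷ 3 ∷ 17 ∷ []) ∷ []) ∷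
    ((14 ∷ 12 ∷ 19 ∷ []) ∷ (2 ∷ 0 ∷ 22 ∷ []) ∷ (5 ∷ 3 ∷ 25 ∷ []) ∷ (8 ∷ 6 ∷ 28 ∷ []) ∷ (11 ∷ 9 ∷ 16 ∷ []) ∷ (26 ∷ 7 ∷ 21 ∷ []) ∷ (29 ∷ 10 ∷ 24 ∷ []) ∷ (17 ∷ 13 ∷ 27 ∷ []) ∷ (20 ∷ 1 ∷ 15 ∷ []) ∷ (23 ∷ 4 ∷ 18 ∷ []) ∷ []) ∷
    []
  )
  ( ((0 ∷ 3 ∷ 6 ∷ 9 ∷ 12 ∷ []) ∷ (1 ∷ 4 ∷ 7 ∷ 10 ∷ 13 ∷ []) ∷ (2 ∷ 5 ∷ 8 ∷ 11 ∷ 14 ∷ []) ∷ (15 ∷ 21 ∷ 27 ∷ 18 ∷ 24 ∷ []) ∷ (16 ∷ 22 ∷ 28 ∷ 19 ∷ 25 ∷ []) ∷ (17 ∷ 23 ∷ 29 ∷ 20 ∷ 26 ∷ []) ∷ []) ∷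
    ((24 ∷ 0 ∷ 27 ∷ 9 ∷ 1 ∷ []) ∷ (29 ∷ 5 ∷ 17 ∷ 14 ∷ 6 ∷ []) ∷ (19 ∷ 10 ∷ 22 ∷ 4 ∷ 11 ∷ []) ∷ (26 ∷ 15 ∷ 23 ∷ 7 ∷ 13 ∷ []) ∷ (16 ∷ 20 ∷ 28 ∷ 12 ∷ 3 ∷ []) ∷ (21 ∷ 25 ∷ 18 ∷ 2 ∷ 8 ∷ []) ∷ []) ∷
    ((25 ∷ 1 ∷ 28 ∷ 10 ∷ 2 ∷ []) ∷ (15 ∷ 6 ∷ 18 ∷ 0 ∷ 7 ∷ []) ∷ (20 ∷ 11 ∷ 23 ∷ 5 ∷ 12 ∷ []) ∷ (27 ∷ 16 ∷ 24 ∷ 8 ∷ 14 ∷ []) ∷ (17 ∷ 21 ∷ 29 ∷ 13 ∷ 4 ∷ []) ∷ (22 ∷ 26 ∷ 19 ∷ 3 ∷ 9 ∷ []) ∷ []) ∷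
    ((26 ∷ 2 ∷ 29 ∷ 11 ∷ 3 ∷ []) ∷ (16 ∷ 7 ∷ 19 ∷ 1 ∷ 8 ∷ []) ∷ (21 ∷ 12 ∷ 24 ∷ 6 ∷ 13 ∷ []) ∷ (28 ∷ 17 ∷ 25 ∷ 9 ∷ 0 ∷ []) ∷ (18 ∷ 22 ∷ 15 ∷ 14 ∷ 5 ∷ []) ∷ (23 ∷ 27 ∷ 20 ∷ 4 ∷ 10 ∷ []) ∷ []) ∷
    ((27 ∷ 3 ∷ 15 ∷ 12 ∷ 4 ∷ []) ∷ (17 ∷ 8 ∷ 20 ∷ 2 ∷ 9 ∷ []) ∷ (22 ∷ 13 ∷ 25 ∷ 7 ∷ 14 ∷ []) ∷ (29 ∷ 18 ∷ 26 ∷ 10 ∷ 1 ∷ []) ∷ (19 ∷ 23 ∷ 16 ∷ 0 ∷ 6 ∷ []) ∷ (24 ∷ 28 ∷ 21 ∷ 5 ∷ 11 ∷ []) ∷ []) ∷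
    ((28 ∷ 4 ∷ 16 ∷ 13 ∷ 5 ∷ []) ∷ (18 ∷ 9 ∷ 21 ∷ 3 ∷ 10 ∷ []) ∷ (23 ∷ 14 ∷ 26 ∷ 8 ∷ 0 ∷ []) ∷ (15 ∷ 19 ∷ 27 ∷ 11 ∷ 2 ∷ []) ∷ (20 ∷ 24 ∷ 17 ∷ 1 ∷ 7 ∷ []) ∷ (25 ∷ 29 ∷ 22 ∷ 6 ∷ 12 ∷ []) ∷ []) ∷
    []
  )

hwp₃₀ 9 _ _ _ refl = hwp₃₀-from-cycles
  ( ((0 ∷ 18 ∷ 1 ∷ []) ∷ (3 ∷ 21 ∷ 4 ∷ []) ∷ (6 ∷ 24 ∷ 7 ∷ []) ∷ (9 ∷ 27 ∷ 10 ∷ []) ∷ (12 ∷ 15 ∷ 13 ∷ []) ∷ (16 ∷ 8 ∷ 17 ∷ []) ∷ (19 ∷ 11 ∷ 20 ∷ []) ∷ (22 ∷ 14 ∷ 23 ∷ []) ∷ (25 ∷ 2 ∷ 26 ∷ []) ∷ (28 ∷ 5 ∷ 29 ∷ []) ∷ []) ∷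
    ((1 ∷ 19 ∷ 2 ∷ []) ∷ (4 ∷ 22 ∷ 5 ∷ []) ∷ (7 ∷ 25 ∷ 8 ∷ []) ∷ (10 ∷ 28 ∷ 11 ∷ []) ∷ (13 ∷ 16 ∷ 14 ∷ []) ∷ (17 ∷ 9 ∷ 18 ∷ []) ∷ (20 ∷ 12 ∷ 21 ∷ []) ∷ (23 ∷ 0 ∷ 24 ∷ []) ∷ (26 ∷ 3 ∷ 27 ∷ []) ∷ (29 ∷ 6 ∷ 15 ∷ []) ∷ []) ∷
    ((2 ∷ 20 ∷ 3 ∷ []) ∷ (5 ∷ 23 ∷ 6 ∷ []) ∷ (8 ∷ 26 ∷ 9 ∷ []) ∷ (11 ∷ 29 ∷ 12 ∷ []) ∷ (14 ∷ 17 ∷ 0 ∷ []) ∷ (18 ∷ 10 ∷ 19 ∷ []) ∷ (21 ∷ 13 ∷ 22 ∷ []) ∷ (24 ∷ 1 ∷ 25 ∷ []) ∷ (27 ∷ 4 ∷ 28 ∷ []) ∷ (15 ∷ 7 ∷ 16 ∷ []) ∷ []) ∷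
    ((0 ∷ 7 ∷ 2 ∷ []) ∷ (3 ∷ 10 ∷ 5 ∷ []) ∷ (6 ∷ 13 ∷ 8 ∷ []) ∷ (9 ∷ 1 ∷ 11 ∷ []) ∷ (12 ∷ 4 ∷ 14 ∷ []) ∷ (15 ∷ 22 ∷ 17 ∷ []) ∷ (18 ∷ 25 ∷ 20 ∷ []) ∷ (21 ∷ 28 ∷ 23 ∷ []) ∷ (24 ∷ 16 ∷ 26 ∷ []) ∷ (27 ∷ 19 ∷ 29 ∷ []) ∷ []) ∷
    ((1 ∷ 8 ∷ 3 ∷ []) ∷ (4 ∷ 11 ∷ 6 ∷ []) ∷ (7 ∷ 14 ∷ 9 ∷ []) ∷ (10 ∷ 2 ∷ 12 ∷ []) ∷ (13 ∷ 5 ∷ 0 ∷ []) ∷ (16 ∷ 23 ∷ 18 ∷ []) ∷ (19 ∷ 26 ∷ 21 ∷ []) ∷ (22 ∷ 29 ∷ 24 ∷ []) ∷ (25 ∷ 17 ∷ 27 ∷ []) ∷ (28 ∷ 20 ∷ 15 ∷ []) ∷ []) ∷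
    ((2 ∷ 9 ∷ 4 ∷ []) ∷ (5 ∷ 12 ∷ 7 ∷ []) ∷ (8 ∷ 0 ∷ 10 ∷ []) ∷ (11 ∷ 3 ∷ 13 ∷ []) ∷ (14 ∷ 6 ∷ 1 ∷ []) ∷ (17 ∷ 24 ∷ 19 ∷ []) ∷ (20 ∷ 27 ∷ 22 ∷ []) ∷ (23 ∷ 15 ∷ 25 ∷ []) ∷ (26 ∷ 18 ∷ 28 ∷ []) ∷ (29 ∷ 21 ∷ 16 ∷ []) ∷ []) ∷
    ((0 ∷ 4 ∷ 20 ∷ []) ∷ (3 ∷ 7 ∷ 23 ∷ []) ∷ (6 ∷ 10 ∷ 26 ∷ []) ∷ (9 ∷ 13 ∷ 29 ∷ []) ∷ (12 ∷ 1 ∷ 17 ∷ []) ∷ (15 ∷ 19 ∷ 8 ∷ []) ∷ (18 ∷ 22 ∷ 11 ∷ []) ∷ (21 ∷ 25 ∷ 14 ∷ []) ∷ (24 ∷ 28 ∷ 2 ∷ []) ∷ (27 ∷ 16 ∷ 5 ∷ []) ∷ []) ∷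
    ((1 ∷ 5 ∷ 21 ∷ []) ∷ (4 ∷ 8 ∷ 24 ∷ []) ∷ (7 ∷ 11 ∷ 27 ∷ []) ∷ (10 ∷ 14 ∷ 15 ∷ []) ∷ (13 ∷ 2 ∷ 18 ∷ []) ∷ (16 ∷ 20 ∷ 9 ∷ []) ∷ (19 ∷ 23 ∷ 12 ∷ []) ∷ (22 ∷ 26 ∷ 0 ∷ []) ∷ (25 ∷ 29 ∷ 3 ∷ []) ∷ (28 ∷ 17 ∷ 6 ∷ []) ∷ []) ∷
    ((2 ∷ 6 ∷ 22 ∷ []) ∷ (5 ∷ 9 ∷ 25 ∷ []) ∷ (8 ∷ 12 ∷ 28 ∷ []) ∷ (11 ∷ 0 ∷ 16 ∷ []) ∷ (14 ∷ 3 ∷ 19 ∷ []) ∷ (17 ∷ 21 ∷ 10 ∷ []) ∷ (20 ∷ 24 ∷ 13 ∷ []) ∷ (23 ∷ 27 ∷ 1 ∷ []) ∷ (26 ∷ 15 ∷ 4 ∷ []) ∷ (29 ∷ 18 ∷ 7 ∷ []) ∷ []) ∷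
    []
  )
  ( ((10 ∷ 22 ∷ 12 ∷ 18 ∷ 4 ∷ []) ∷ (0 ∷ 27 ∷ 2 ∷ 23 ∷ 9 ∷ []) ∷ (5 ∷ 17 ∷ 7 ∷ 28 ∷ 14 ∷ []) ∷ (20 ∷ 1 ∷ 13 ∷ 26 ∷ 29 ∷ []) ∷ (25 ∷ 6 ∷ 3 ∷ 16 ∷ 19 ∷ []) ∷ (15 ∷ 11 ∷ 8 ∷ 21 ∷ 24 ∷ []) ∷ []) ∷
    ((11 ∷ 23 ∷ 13 ∷ 19 ∷ 5 ∷ []) ∷ (1 ∷ 28 ∷ 3 ∷ 24 ∷ 10 ∷ []) ∷ (6 ∷ 18 ∷ 8 ∷ 29 ∷ 0 ∷ []) ∷ (21 ∷ 2 ∷ 14 ∷ 27 ∷ 15 ∷ []) ∷ (26 ∷ 7 ∷ 4 ∷ 17 ∷ 20 ∷ []) ∷ (16 ∷ 12 ∷ 9 ∷ 22 ∷ 25 ∷ []) ∷ []) ∷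
    ((12 ∷ 24 ∷ 14 ∷ 20 ∷ 6 ∷ []) ∷ (2 ∷ 29 ∷ 4 ∷ 25 ∷ 11 ∷ []) ∷ (7 ∷ 19 ∷ 9 ∷ 15 ∷ 1 ∷ []) ∷ (22 ∷ 3 ∷ 0 ∷ 28 ∷ 16 ∷ []) ∷ (27 ∷ 8 ∷ 5 ∷ 18 ∷ 21 ∷ []) ∷ (17 ∷ 13 ∷ 10 ∷ 23 ∷ 26 ∷ []) ∷ []) ∷
    ((13 ∷ 25 ∷ 0 ∷ 21 ∷ 7 ∷ []) ∷ (3 ∷ 15 ∷ 5 ∷ 26 ∷ 12 ∷ []) ∷ (8 ∷ 20 ∷ 10 ∷ 16 ∷ 2 ∷ []) ∷ (23 ∷ 4 ∷ 1 ∷ 29 ∷ 17 ∷ []) ∷ (28 ∷ 9 ∷ 6 ∷ 19 ∷ 22 ∷ []) ∷ (18 ∷ 14 ∷ 11 ∷ 24 ∷ 27 ∷ []) ∷ []) ∷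
    ((14 ∷ 26 ∷ 1 ∷ 22 ∷ 8 ∷ []) ∷ (4 ∷ 16 ∷ 6 ∷ 27 ∷ 13 ∷ []) ∷ (9 ∷ 21 ∷ 11 ∷ 17 ∷ 3 ∷ []) ∷ (24 ∷ 5 ∷ 2 ∷ 15 ∷ 18 ∷ []) ∷ (29 ∷ 10 ∷ 7 ∷ 20 ∷ 23 ∷ []) ∷ (19 ∷ 0 ∷ 12 ∷ 25 ∷ 28 ∷ []) ∷ []) ∷
    []
  )

hwp₃₀ 10 _ _ _ refl = hwp₃₀-from-cycles
  ( ((17 ∷ 27 ∷ 22 ∷ []) ∷ (0 ∷ 6 ∷ 2 ∷ []) ∷ (5 ∷ 11 ∷ 7 ∷ []) ∷ (10 ∷ 1 ∷ 12 ∷ []) ∷ (24 ∷ 14 ∷ 16 ∷ []) ∷ (29 ∷ 4 ∷ 21 ∷ []) ∷ (19 ∷ 9 ∷ 26 ∷ []) ∷ (20 ∷ 18 ∷ 13 ∷ []) ∷ (25 ∷ 23 ∷ 3 ∷ []) ∷ (15 ∷ 28 ∷ 8 ∷ []) ∷ []) ∷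
    ((18 ∷ 28 ∷ 23 ∷ []) ∷ (1 ∷ 7 ∷ 3 ∷ []) ∷ (6 ∷ 12 ∷ 8 ∷ []) ∷ (11 ∷ 2 ∷ 13 ∷ []) ∷ (25 ∷ 0 ∷ 17 ∷ []) ∷ (15 ∷ 5 ∷ 22 ∷ []) ∷ (20 ∷ 10 ∷ 27 ∷ []) ∷ (21 ∷ 19 ∷ 14 ∷ []) ∷ (26 ∷ 24 ∷ 4 ∷ []) ∷ (16 ∷ 29 ∷ 9 ∷ []) ∷ []) ∷
    ((19 ∷ 29 ∷ 24 ∷ []) ∷ (2 ∷ 8 ∷ 4 ∷ []) ∷ (7 ∷ 13 ∷ 9 ∷ []) ∷ (12 ∷ 3 ∷ 14 ∷ []) ∷ (26 ∷ 1 ∷ 18 ∷ []) ∷ (16 ∷ 6 ∷ 23 ∷ []) ∷ (21 ∷ 11 ∷ 28 ∷ []) ∷ (22 ∷ 20 ∷ 0 ∷ []) ∷ (27 ∷ 25 ∷ 5 ∷ []) ∷ (17 ∷ 15 ∷ 10 ∷ []) ∷ []) ∷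
    ((20 ∷ 15 ∷ 25 ∷ []) ∷ (3 ∷ 9 ∷ 5 ∷ []) ∷ (8 ∷ 14 ∷ 10 ∷ []) ∷ (13 ∷ 4 ∷ 0 ∷ []) ∷ (27 ∷ 2 ∷ 19 ∷ []) ∷ (17 ∷ 7 ∷ 24 ∷ []) ∷ (22 ∷ 12 ∷ 29 ∷ []) ∷ (23 ∷ 21 ∷ 1 ∷ []) ∷ (28 ∷ 26 ∷ 6 ∷ []) ∷ (18 ∷ 16 ∷ 11 ∷ []) ∷ []) ∷
    ((21 ∷ 16 ∷ 26 ∷ []) ∷ (4 ∷ 10 ∷ 6 ∷ []) ∷ (9 ∷ 0 ∷ 11 ∷ []) ∷ (14 ∷ 5 ∷ 1 ∷ []) ∷ (28 ∷ 3 ∷ 20 ∷ []) ∷ (18 ∷ 8 ∷ 25 ∷ []) ∷ (23 ∷ 13 ∷ 15 ∷ []) ∷ (24 ∷ 22 ∷ 2 ∷ []) ∷ (29 ∷ 27 ∷ 7 ∷ []) ∷ (19 ∷ 17 ∷ 12 ∷ []) ∷ []) ∷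
    ((0 ∷ 10 ∷ 5 ∷ []) ∷ (3 ∷ 27 ∷ 26 ∷ []) ∷ (8 ∷ 17 ∷ 16 ∷ []) ∷ (13 ∷ 22 ∷ 21 ∷ []) ∷ (28 ∷ 24 ∷ 12 ∷ []) ∷ (18 ∷ 29 ∷ 2 ∷ []) ∷ (23 ∷ 19 ∷ 7 ∷ []) ∷ (4 ∷ 25 ∷ 11 ∷ []) ∷ (9 ∷ 15 ∷ 1 ∷ []) ∷ (14 ∷ 20 ∷ 6 ∷ []) ∷ []) ∷
    ((1 ∷ 11 ∷ 6 ∷ []) ∷ (4 ∷ 28 ∷ 27 ∷ []) ∷ (9 ∷ 18 ∷ 17 ∷ []) ∷ (14 ∷ 23 ∷ 22 ∷ []) ∷ (29 ∷ 25 ∷ 13 ∷ []) ∷ (19 ∷ 15 ∷ 3 ∷ []) ∷ (24 ∷ 20 ∷ 8 ∷ []) ∷ (5 ∷ 26 ∷ 12 ∷ []) ∷ (10 ∷ 16 ∷ 2 ∷ []) ∷ (0 ∷ 21 ∷ 7 ∷ []) ∷ []) ∷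
    ((2 ∷ 12 ∷ 7 ∷ []) ∷ (5 ∷ 29 ∷ 28 ∷ []) ∷ (10 ∷ 19 ∷ 18 ∷ []) ∷ (0 ∷ 24 ∷ 23 ∷ []) ∷ (15 ∷ 26 ∷ 14 ∷ []) ∷ (20 ∷ 16 ∷ 4 ∷ []) ∷ (25 ∷ 21 ∷ 9 ∷ []) ∷ (6 ∷ 27 ∷ 13 ∷ []) ∷ (11 ∷ 17 ∷ 3 ∷ []) ∷ (1 ∷ 22 ∷ 8 ∷ []) ∷ []) ∷
    ((3 ∷ 13 ∷ 8 ∷ []) ∷ (6 ∷ 15 ∷ 29 ∷ []) ∷ (11 ∷ 20 ∷ 19 ∷ []) ∷ (1 ∷ 25 ∷ 24 ∷ []) ∷ (16 ∷ 27 ∷ 0 ∷ []) ∷ (21 ∷ 17 ∷ 5 ∷ []) ∷ (26 ∷ 22 ∷ 10 ∷ []) ∷ (7 ∷ 28 ∷ 14 ∷ []) ∷ (12 ∷ 18 ∷ 4 ∷ []) ∷ (2 ∷ 23 ∷ 9 ∷ []) ∷ []) ∷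
    ((4 ∷ 14 ∷ 9 ∷ []) ∷ (7 ∷ 16 ∷ 15 ∷ []) ∷ (12 ∷ 21 ∷ 20 ∷ []) ∷ (2 ∷ 26 ∷ 25 ∷ []) ∷ (17 ∷ 28 ∷ 1 ∷ []) ∷ (22 ∷ 18 ∷ 6 ∷ []) ∷ (27 ∷ 23 ∷ 11 ∷ []) ∷ (8 ∷ 29 ∷ 0 ∷ []) ∷ (13 ∷ 19 ∷ 5 ∷ []) ∷ (3 ∷ 24 ∷ 10 ∷ []) ∷ []) ∷
    []
  )
  ( ((16 ∷ 19 ∷ 22 ∷ 25 ∷ 28 ∷ []) ∷ (5 ∷ 4 ∷ 17 ∷ 6 ∷ 24 ∷ []) ∷ (8 ∷ 7 ∷ 20 ∷ 9 ∷ 27 ∷ []) ∷ (11 ∷ 10 ∷ 23 ∷ 12 ∷ 15 ∷ []) ∷ (14 ∷ 13 ∷ 26 ∷ 0 ∷ 18 ∷ []) ∷ (2 ∷ 1 ∷ 29 ∷ 3 ∷ 21 ∷ []) ∷ []) ∷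
    ((17 ∷ 20 ∷ 23 ∷ 26 ∷ 29 ∷ []) ∷ (6 ∷ 5 ∷ 18 ∷ 7 ∷ 25 ∷ []) ∷ (9 ∷ 8 ∷ 21 ∷ 10 ∷ 28 ∷ []) ∷ (12 ∷ 11 ∷ 24 ∷ 13 ∷ 16 ∷ []) ∷ (0 ∷ 14 ∷ 27 ∷ 1 ∷ 19 ∷ []) ∷ (3 ∷ 2 ∷ 15 ∷ 4 ∷ 22 ∷ []) ∷ []) ∷
    ((18 ∷ 21 ∷ 24 ∷ 27 ∷ 15 ∷ []) ∷ (7 ∷ 6 ∷ 19 ∷ 8 ∷ 26 ∷ []) ∷ (10 ∷ 9 ∷ 22 ∷ 11 ∷ 29 ∷ []) ∷ (13 ∷ 12 ∷ 25 ∷ 14 ∷ 17 ∷ []) ∷ (1 ∷ 0 ∷ 28 ∷ 2 ∷ 20 ∷ []) ∷ (4 ∷ 3 ∷ 16 ∷ 5 ∷ 23 ∷ []) ∷ []) ∷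
    ((0 ∷ 3 ∷ 6 ∷ 9 ∷ 12 ∷ []) ∷ (1 ∷ 4 ∷ 7 ∷ 10 ∷ 13 ∷ []) ∷ (2 ∷ 5 ∷ 8 ∷ 11 ∷ 14 ∷ []) ∷ (15 ∷ 21 ∷ 27 ∷ 18 ∷ 24 ∷ []) ∷ (16 ∷ 22 ∷ 28 ∷ 19 ∷ 25 ∷ []) ∷ (17 ∷ 23 ∷ 29 ∷ 20 ∷ 26 ∷ []) ∷ []) ∷
    []
  )

hwp₃₀ 11 _ _ _ refl = hwp₃₀-from-cycles
  ( ((18 ∷ 28 ∷ 23 ∷ []) ∷ (11 ∷ 13 ∷ 4 ∷ []) ∷ (1 ∷ 3 ∷ 9 ∷ []) ∷ (6 ∷ 8 ∷ 14 ∷ []) ∷ (5 ∷ 25 ∷ 2 ∷ []) ∷ (10 ∷ 15 ∷ 7 ∷ []) ∷ (0 ∷ 20 ∷ 12 ∷ []) ∷ (26 ∷ 19 ∷ 22 ∷ []) ∷ (16 ∷ 24 ∷ 27 ∷ []) ∷ (21 ∷ 29 ∷ 17 ∷ []) ∷ []) ∷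
    ((19 ∷ 29 ∷ 24 ∷ []) ∷ (12 ∷ 14 ∷ 5 ∷ []) ∷ (2 ∷ 4 ∷ 10 ∷ []) ∷ (7 ∷ 9 ∷ 0 ∷ []) ∷ (6 ∷ 26 ∷ 3 ∷ []) ∷ (11 ∷ 16 ∷ 8 ∷ []) ∷ (1 ∷ 21 ∷ 13 ∷ []) ∷ (27 ∷ 20 ∷ 23 ∷ []) ∷ (17 ∷ 25 ∷ 28 ∷ []) ∷ (22 ∷ 15 ∷ 18 ∷ []) ∷ []) ∷
    ((20 ∷ 15 ∷ 25 ∷ []) ∷ (13 ∷ 0 ∷ 6 ∷ []) ∷ (3 ∷ 5 ∷ 11 ∷ []) ∷ (8 ∷ 10 ∷ 1 ∷ []) ∷ (7 ∷ 27 ∷ 4 ∷ []) ∷ (12 ∷ 17 ∷ 9 ∷ []) ∷ (2 ∷ 22 ∷ 14 ∷ []) ∷ (28 ∷ 21 ∷ 24 ∷ []) ∷ (18 ∷ 26 ∷ 29 ∷ []) ∷ (23 ∷ 16 ∷ 19 ∷ []) ∷ []) ∷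
    ((21 ∷ 16 ∷ 26 ∷ []) ∷ (14 ∷ 1 ∷ 7 ∷ []) ∷ (4 ∷ 6 ∷ 12 ∷ []) ∷ (9 ∷ 11 ∷ 2 ∷ []) ∷ (8 ∷ 28 ∷ 5 ∷ []) ∷ (13 ∷ 18 ∷ 10 ∷ []) ∷ (3 ∷ 23 ∷ 0 ∷ []) ∷ (29 ∷ 22 ∷ 25 ∷ []) ∷ (19 ∷ 27 ∷ 15 ∷ []) ∷ (24 ∷ 17 ∷ 20 ∷ []) ∷ []) ∷
    ((22 ∷ 17 ∷ 27 ∷ []) ∷ (0 ∷ 2 ∷ 8 ∷ []) ∷ (5 ∷ 7 ∷ 13 ∷ []) ∷ (10 ∷ 12 ∷ 3 ∷ []) ∷ (9 ∷ 29 ∷ 6 ∷ []) ∷ (14 ∷ 19 ∷ 11 ∷ []) ∷ (4 ∷ 24 ∷ 1 ∷ []) ∷ (15 ∷ 23 ∷ 26 ∷ []) ∷ (20 ∷ 28 ∷ 16 ∷ []) ∷ (25 ∷ 18 ∷ 21 ∷ []) ∷ []) ∷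
    ((0 ∷ 16 ∷ 4 ∷ []) ∷ (3 ∷ 19 ∷ 7 ∷ []) ∷ (6 ∷ 22 ∷ 10 ∷ []) ∷ (9 ∷ 25 ∷ 13 ∷ []) ∷ (12 ∷ 28 ∷ 1 ∷ []) ∷ (14 ∷ 21 ∷ 20 ∷ []) ∷ (2 ∷ 24 ∷ 23 ∷ []) ∷ (5 ∷ 27 ∷ 26 ∷ []) ∷ (8 ∷ 15 ∷ 29 ∷ []) ∷ (11 ∷ 18 ∷ 17 ∷ []) ∷ []) ∷
    ((1 ∷ 17 ∷ 5 ∷ []) ∷ (4 ∷ 20 ∷ 8 ∷ []) ∷ (7 ∷ 23 ∷ 11 ∷ []) ∷ (10 ∷ 26 ∷ 14 ∷ []) ∷ (13 ∷ 29 ∷ 2 ∷ []) ∷ (0 ∷ 22 ∷ 21 ∷ []) ∷ (3 ∷ 25 ∷ 24 ∷ []) ∷ (6 ∷ 28 ∷ 27 ∷ []) ∷ (9 ∷ 16 ∷ 15 ∷ []) ∷ (12 ∷ 19 ∷ 18 ∷ []) ∷ []) ∷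
    ((2 ∷ 18 ∷ 6 ∷ []) ∷ (5 ∷ 21 ∷ 9 ∷ []) ∷ (8 ∷ 24 ∷ 12 ∷ []) ∷ (11 ∷ 27 ∷ 0 ∷ []) ∷ (14 ∷ 15 ∷ 3 ∷ []) ∷ (1 ∷ 23 ∷ 22 ∷ []) ∷ (4 ∷ 26 ∷ 25 ∷ []) ∷ (7 ∷ 29 ∷ 28 ∷ []) ∷ (10 ∷ 17 ∷ 16 ∷ []) ∷ (13 ∷ 20 ∷ 19 ∷ []) ∷ []) ∷
    ((12 ∷ 23 ∷ 25 ∷ []) ∷ (0 ∷ 26 ∷ 28 ∷ []) ∷ (3 ∷ 29 ∷ 16 ∷ []) ∷ (6 ∷ 17 ∷ 19 ∷ []) ∷ (9 ∷ 20 ∷ 22 ∷ []) ∷ (4 ∷ 14 ∷ 18 ∷ []) ∷ (7 ∷ 2 ∷ 21 ∷ []) ∷ (10 ∷ 5 ∷ 24 ∷ []) ∷ (13 ∷ 8 ∷ 27 ∷ []) ∷ (1 ∷ 11 ∷ 15 ∷ []) ∷ []) ∷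
    ((13 ∷ 24 ∷ 26 ∷ []) ∷ (1 ∷ 27 ∷ 29 ∷ []) ∷ (4 ∷ 15 ∷ 17 ∷ []) ∷ (7 ∷ 18 ∷ 20 ∷ []) ∷ (10 ∷ 21 ∷ 23 ∷ []) ∷ (5 ∷ 0 ∷ 19 ∷ []) ∷ (8 ∷ 3 ∷ 22 ∷ []) ∷ (11 ∷ 6 ∷ 25 ∷ []) ∷ (14 ∷ 9 ∷ 28 ∷ []) ∷ (2 ∷ 12 ∷ 16 ∷ []) ∷ []) ∷
    ((14 ∷ 25 ∷ 27 ∷ []) ∷ (2 ∷ 28 ∷ 15 ∷ []) ∷ (5 ∷ 16 ∷ 18 ∷ []) ∷ (8 ∷ 19 ∷ 21 ∷ []) ∷ (11 ∷ 22 ∷ 24 ∷ []) ∷ (6 ∷ 1 ∷ 20 ∷ []) ∷ (9 ∷ 4 ∷ 23 ∷ []) ∷ (12 ∷ 7 ∷ 26 ∷ []) ∷ (0 ∷ 10 ∷ 29 ∷ []) ∷ (3 ∷ 13 ∷ 17 ∷ []) ∷ []) ∷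
    []
  )
  ( ((16 ∷ 25 ∷ 19 ∷ 28 ∷ 22 ∷ []) ∷ (18 ∷ 1 ∷ 26 ∷ 8 ∷ 9 ∷ []) ∷ (21 ∷ 4 ∷ 29 ∷ 11 ∷ 12 ∷ []) ∷ (24 ∷ 7 ∷ 17 ∷ 14 ∷ 0 ∷ []) ∷ (27 ∷ 10 ∷ 20 ∷ 2 ∷ 3 ∷ []) ∷ (15 ∷ 13 ∷ 23 ∷ 5 ∷ 6 ∷ []) ∷ []) ∷
    ((17 ∷ 26 ∷ 20 ∷ 29 ∷ 23 ∷ []) ∷ (19 ∷ 2 ∷ 27 ∷ 9 ∷ 10 ∷ []) ∷ (22 ∷ 5 ∷ 15 ∷ 12 ∷ 13 ∷ []) ∷ (25 ∷ 8 ∷ 18 ∷ 0 ∷ 1 ∷ []) ∷ (28 ∷ 11 ∷ 21 ∷ 3 ∷ 4 ∷ []) ∷ (16 ∷ 14 ∷ 24 ∷ 6 ∷ 7 ∷ []) ∷ []) ∷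
    ((18 ∷ 27 ∷ 21 ∷ 15 ∷ 24 ∷ []) ∷ (20 ∷ 3 ∷ 28 ∷ 10 ∷ 11 ∷ []) ∷ (23 ∷ 6 ∷ 16 ∷ 13 ∷ 14 ∷ []) ∷ (26 ∷ 9 ∷ 19 ∷ 1 ∷ 2 ∷ []) ∷ (29 ∷ 12 ∷ 22 ∷ 4 ∷ 5 ∷ []) ∷ (17 ∷ 0 ∷ 25 ∷ 7 ∷ 8 ∷ []) ∷ []) ∷
    []
  )

hwp₃₀ 12 _ _ _ refl = hwp₃₀-from-cycles
  ( ((11 ∷ 16 ∷ 10 ∷ []) ∷ (14 ∷ 19 ∷ 13 ∷ []) ∷ (2 ∷ 22 ∷ 1 ∷ []) ∷ (5 ∷ 25 ∷ 4 ∷ []) ∷ (8 ∷ 28 ∷ 7 ∷ []) ∷ (9 ∷ 26 ∷ 27 ∷ []) ∷ (12 ∷ 29 ∷ 15 ∷ []) ∷ (0 ∷ 17 ∷ 18 ∷ []) ∷ (3 ∷ 20 ∷ 21 ∷ []) ∷ (6 ∷ 23 ∷ 24 ∷ []) ∷ []) ∷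
    ((27 ∷ 14 ∷ 28 ∷ []) ∷ (15 ∷ 2 ∷ 16 ∷ []) ∷ (18 ∷ 5 ∷ 19 ∷ []) ∷ (21 ∷ 8 ∷ 22 ∷ []) ∷ (24 ∷ 11 ∷ 25 ∷ []) ∷ (29 ∷ 13 ∷ 3 ∷ []) ∷ (17 ∷ 1 ∷ 6 ∷ []) ∷ (20 ∷ 4 ∷ 9 ∷ []) ∷ (23 ∷ 7 ∷ 12 ∷ []) ∷ (26 ∷ 10 ∷ 0 ∷ []) ∷ []) ∷
    ((11 ∷ 9 ∷ 21 ∷ []) ∷ (14 ∷ 12 ∷ 24 ∷ []) ∷ (2 ∷ 0 ∷ 27 ∷ []) ∷ (5 ∷ 3 ∷ 15 ∷ []) ∷ (8 ∷ 6 ∷ 18 ∷ []) ∷ (29 ∷ 4 ∷ 28 ∷ []) ∷ (17 ∷ 7 ∷ 16 ∷ []) ∷ (20 ∷ 10 ∷ 19 ∷ []) ∷ (23 ∷ 13 ∷ 22 ∷ []) ∷ (26 ∷ 1 ∷ 25 ∷ []) ∷ []) ∷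
    ((24 ∷ 4 ∷ 16 ∷ []) ∷ (27 ∷ 7 ∷ 19 ∷ []) ∷ (15 ∷ 10 ∷ 22 ∷ []) ∷ (18 ∷ 13 ∷ 25 ∷ []) ∷ (21 ∷ 1 ∷ 28 ∷ []) ∷ (12 ∷ 11 ∷ 17 ∷ []) ∷ (0 ∷ 14 ∷ 20 ∷ []) ∷ (3 ∷ 2 ∷ 23 ∷ []) ∷ (6 ∷ 5 ∷ 26 ∷ []) ∷ (9 ∷ 8 ∷ 29 ∷ []) ∷ []) ∷
    ((29 ∷ 27 ∷ 10 ∷ []) ∷ (17 ∷ 15 ∷ 13 ∷ []) ∷ (20 ∷ 18 ∷ 1 ∷ []) ∷ (23 ∷ 21 ∷ 4 ∷ []) ∷ (26 ∷ 24 ∷ 7 ∷ []) ∷ (6 ∷ 11 ∷ 19 ∷ []) ∷ (9 ∷ 14 ∷ 22 ∷ []) ∷ (12 ∷ 2 ∷ 25 ∷ []) ∷ (0 ∷ 5 ∷ 28 ∷ []) ∷ (3 ∷ 8 ∷ 16 ∷ []) ∷ []) ∷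
    ((1 ∷ 11 ∷ 15 ∷ []) ∷ (4 ∷ 14 ∷ 18 ∷ []) ∷ (7 ∷ 2 ∷ 21 ∷ []) ∷ (10 ∷ 5 ∷ 24 ∷ []) ∷ (13 ∷ 8 ∷ 27 ∷ []) ∷ (19 ∷ 17 ∷ 9 ∷ []) ∷ (22 ∷ 20 ∷ 12 ∷ []) ∷ (25 ∷ 23 ∷ 0 ∷ []) ∷ (28 ∷ 26 ∷ 3 ∷ []) ∷ (16 ∷ 29 ∷ 6 ∷ []) ∷ []) ∷
    ((0 ∷ 16 ∷ 21 ∷ []) ∷ (3 ∷ 19 ∷ 24 ∷ []) ∷ (6 ∷ 22 ∷ 27 ∷ []) ∷ (9 ∷ 25 ∷ 15 ∷ []) ∷ (12 ∷ 28 ∷ 18 ∷ []) ∷ (8 ∷ 17 ∷ 10 ∷ []) ∷ (11 ∷ 20 ∷ 13 ∷ []) ∷ (14 ∷ 23 ∷ 1 ∷ []) ∷ (2 ∷ 26 ∷ 4 ∷ []) ∷ (5 ∷ 29 ∷ 7 ∷ []) ∷ []) ∷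
    ((21 ∷ 5 ∷ 13 ∷ []) ∷ (7 ∷ 18 ∷ 9 ∷ []) ∷ (8 ∷ 4 ∷ 12 ∷ []) ∷ (19 ∷ 15 ∷ 23 ∷ []) ∷ (14 ∷ 26 ∷ 16 ∷ []) ∷ (0 ∷ 1 ∷ 29 ∷ []) ∷ (24 ∷ 20 ∷ 2 ∷ []) ∷ (22 ∷ 11 ∷ 3 ∷ []) ∷ (28 ∷ 10 ∷ 6 ∷ []) ∷ (25 ∷ 27 ∷ 17 ∷ []) ∷ []) ∷
    ((24 ∷ 8 ∷ 1 ∷ []) ∷ (10 ∷ 21 ∷ 12 ∷ []) ∷ (11 ∷ 7 ∷ 0 ∷ []) ∷ (22 ∷ 18 ∷ 26 ∷ []) ∷ (2 ∷ 29 ∷ 19 ∷ []) ∷ (3 ∷ 4 ∷ 17 ∷ []) ∷ (27 ∷ 23 ∷ 5 ∷ []) ∷ (25 ∷ 14 ∷ 6 ∷ []) ∷ (16 ∷ 13 ∷ 9 ∷ []) ∷ (28 ∷ 15 ∷ 20 ∷ []) ∷ []) ∷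
    ((27 ∷ 11 ∷ 4 ∷ []) ∷ (13 ∷ 24 ∷ 0 ∷ []) ∷ (14 ∷ 10 ∷ 3 ∷ []) ∷ (25 ∷ 21 ∷ 29 ∷ []) ∷ (5 ∷ 17 ∷ 22 ∷ []) ∷ (6 ∷ 7 ∷ 20 ∷ []) ∷ (15 ∷ 26 ∷ 8 ∷ []) ∷ (28 ∷ 2 ∷ 9 ∷ []) ∷ (19 ∷ 1 ∷ 12 ∷ []) ∷ (16 ∷ 18 ∷ 23 ∷ []) ∷ []) ∷
    ((15 ∷ 14 ∷ 7 ∷ []) ∷ (1 ∷ 27 ∷ 3 ∷ []) ∷ (2 ∷ 13 ∷ 6 ∷ []) ∷ (28 ∷ 24 ∷ 17 ∷ []) ∷ (8 ∷ 20 ∷ 25 ∷ []) ∷ (9 ∷ 10 ∷ 23 ∷ []) ∷ (18 ∷ 29 ∷ 11 ∷ []) ∷ (16 ∷ 5 ∷ 12 ∷ []) ∷ (22 ∷ 4 ∷ 0 ∷ []) ∷ (19 ∷ 21 ∷ 26 ∷ []) ∷ []) ∷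
    ((18 ∷ 2 ∷ 10 ∷ []) ∷ (4 ∷ 15 ∷ 6 ∷ []) ∷ (5 ∷ 1 ∷ 9 ∷ []) ∷ (16 ∷ 27 ∷ 20 ∷ []) ∷ (11 ∷ 23 ∷ 28 ∷ []) ∷ (12 ∷ 13 ∷ 26 ∷ []) ∷ (21 ∷ 17 ∷ 14 ∷ []) ∷ (19 ∷ 8 ∷ 0 ∷ []) ∷ (25 ∷ 7 ∷ 3 ∷ []) ∷ (22 ∷ 24 ∷ 29 ∷ []) ∷ []) ∷
    []
  )
  ( ((0 ∷ 3 ∷ 6 ∷ 9 ∷ 12 ∷ []) ∷ (15 ∷ 18 ∷ 21 ∷ 24 ∷ 27 ∷ []) ∷ (1 ∷ 4 ∷ 7 ∷ 10 ∷ 13 ∷ []) ∷ (16 ∷ 19 ∷ 22 ∷ 25 ∷ 28 ∷ []) ∷ (2 ∷ 5 ∷ 8 ∷ 11 ∷ 14 ∷ []) ∷ (17 ∷ 20 ∷ 23 ∷ 26 ∷ 29 ∷ []) ∷ []) ∷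
    ((0 ∷ 6 ∷ 12 ∷ 3 ∷ 9 ∷ []) ∷ (15 ∷ 21 ∷ 27 ∷ 18 ∷ 24 ∷ []) ∷ (1 ∷ 7 ∷ 13 ∷ 4 ∷ 10 ∷ []) ∷ (16 ∷ 22 ∷ 28 ∷ 19 ∷ 25 ∷ []) ∷ (2 ∷ 8 ∷ 14 ∷ 5 ∷ 11 ∷ []) ∷ (17 ∷ 23 ∷ 29 ∷ 20 ∷ 26 ∷ []) ∷ []) ∷
    []
  )

hwp₃₀ 13 _ _ _ refl = hwp₃₀-from-cycles
  ( ((4 ∷ 14 ∷ 9 ∷ []) ∷ (5 ∷ 15 ∷ 27 ∷ []) ∷ (10 ∷ 20 ∷ 17 ∷ []) ∷ (0 ∷ 25 ∷ 22 ∷ []) ∷ (16 ∷ 2 ∷ 3 ∷ []) ∷ (21 ∷ 7 ∷ 8 ∷ []) ∷ (26 ∷ 12 ∷ 13 ∷ []) ∷ (6 ∷ 29 ∷ 18 ∷ []) ∷ (11 ∷ 19 ∷ 23 ∷ []) ∷ (1 ∷ 24 ∷ 28 ∷ []) ∷ []) ∷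
    ((5 ∷ 0 ∷ 10 ∷ []) ∷ (6 ∷ 16 ∷ 28 ∷ []) ∷ (11 ∷ 21 ∷ 18 ∷ []) ∷ (1 ∷ 26 ∷ 23 ∷ []) ∷ (17 ∷ 3 ∷ 4 ∷ []) ∷ (22 ∷ 8 ∷ 9 ∷ []) ∷ (27 ∷ 13 ∷ 14 ∷ []) ∷ (7 ∷ 15 ∷ 19 ∷ []) ∷ (12 ∷ 20 ∷ 24 ∷ []) ∷ (2 ∷ 25 ∷ 29 ∷ []) ∷ []) ∷
    ((6 ∷ 1 ∷ 11 ∷ []) ∷ (7 ∷ 17 ∷ 29 ∷ []) ∷ (12 ∷ 22 ∷ 19 ∷ []) ∷ (2 ∷ 27 ∷ 24 ∷ []) ∷ (18 ∷ 4 ∷ 5 ∷ []) ∷ (23 ∷ 9 ∷ 10 ∷ []) ∷ (28 ∷ 14 ∷ 0 ∷ []) ∷ (8 ∷ 16 ∷ 20 ∷ []) ∷ (13 ∷ 21 ∷ 25 ∷ []) ∷ (3 ∷ 26 ∷ 15 ∷ []) ∷ []) ∷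
    ((7 ∷ 2 ∷ 12 ∷ []) ∷ (8 ∷ 18 ∷ 15 ∷ []) ∷ (13 ∷ 23 ∷ 20 ∷ []) ∷ (3 ∷ 28 ∷ 25 ∷ []) ∷ (19 ∷ 5 ∷ 6 ∷ []) ∷ (24 ∷ 10 ∷ 11 ∷ []) ∷ (29 ∷ 0 ∷ 1 ∷ []) ∷ (9 ∷ 17 ∷ 21 ∷ []) ∷ (14 ∷ 22 ∷ 26 ∷ []) ∷ (4 ∷ 27 ∷ 16 ∷ []) ∷ []) ∷
    ((8 ∷ 3 ∷ 13 ∷ []) ∷ (9 ∷ 19 ∷ 16 ∷ []) ∷ (14 ∷ 24 ∷ 21 ∷ []) ∷ (4 ∷ 29 ∷ 26 ∷ []) ∷ (20 ∷ 6 ∷ 7 ∷ []) ∷ (25 ∷ 11 ∷ 12 ∷ []) ∷ (15 ∷ 1 ∷ 2 ∷ []) ∷ (10 ∷ 18 ∷ 22 ∷ []) ∷ (0 ∷ 23 ∷ 27 ∷ []) ∷ (5 ∷ 28 ∷ 17 ∷ []) ∷ []) ∷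
    ((15 ∷ 25 ∷ 20 ∷ []) ∷ (2 ∷ 6 ∷ 0 ∷ []) ∷ (7 ∷ 11 ∷ 5 ∷ []) ∷ (12 ∷ 1 ∷ 10 ∷ []) ∷ (17 ∷ 24 ∷ 8 ∷ []) ∷ (22 ∷ 29 ∷ 13 ∷ []) ∷ (27 ∷ 19 ∷ 3 ∷ []) ∷ (16 ∷ 18 ∷ 14 ∷ []) ∷ (21 ∷ 23 ∷ 4 ∷ []) ∷ (26 ∷ 28 ∷ 9 ∷ []) ∷ []) ∷
    ((16 ∷ 26 ∷ 21 ∷ []) ∷ (3 ∷ 7 ∷ 1 ∷ []) ∷ (8 ∷ 12 ∷ 6 ∷ []) ∷ (13 ∷ 2 ∷ 11 ∷ []) ∷ (18 ∷ 25 ∷ 9 ∷ []) ∷ (23 ∷ 15 ∷ 14 ∷ []) ∷ (28 ∷ 20 ∷ 4 ∷ []) ∷ (17 ∷ 19 ∷ 0 ∷ []) ∷ (22 ∷ 24 ∷ 5 ∷ []) ∷ (27 ∷ 29 ∷ 10 ∷ []) ∷ []) ∷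
    ((17 ∷ 27 ∷ 22 ∷ []) ∷ (4 ∷ 8 ∷ 2 ∷ []) ∷ (9 ∷ 13 ∷ 7 ∷ []) ∷ (14 ∷ 3 ∷ 12 ∷ []) ∷ (19 ∷ 26 ∷ 10 ∷ []) ∷ (24 ∷ 16 ∷ 0 ∷ []) ∷ (29 ∷ 21 ∷ 5 ∷ []) ∷ (18 ∷ 20 ∷ 1 ∷ []) ∷ (23 ∷ 25 ∷ 6 ∷ []) ∷ (28 ∷ 15 ∷ 11 ∷ []) ∷ []) ∷
    ((18 ∷ 28 ∷ 23 ∷ []) ∷ (5 ∷ 9 ∷ 3 ∷ []) ∷ (10 ∷ 14 ∷ 8 ∷ []) ∷ (0 ∷ 4 ∷ 13 ∷ []) ∷ (20 ∷ 27 ∷ 11 ∷ []) ∷ (25 ∷ 17 ∷ 1 ∷ []) ∷ (15 ∷ 22 ∷ 6 ∷ []) ∷ (19 ∷ 21 ∷ 2 ∷ []) ∷ (24 ∷ 26 ∷ 7 ∷ []) ∷ (29 ∷ 16 ∷ 12 ∷ []) ∷ []) ∷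
    ((19 ∷ 29 ∷ 24 ∷ []) ∷ (6 ∷ 10 ∷ 4 ∷ []) ∷ (11 ∷ 0 ∷ 9 ∷ []) ∷ (1 ∷ 5 ∷ 14 ∷ []) ∷ (21 ∷ 28 ∷ 12 ∷ []) ∷ (26 ∷ 18 ∷ 2 ∷ []) ∷ (16 ∷ 23 ∷ 7 ∷ []) ∷ (20 ∷ 22 ∷ 3 ∷ []) ∷ (25 ∷ 27 ∷ 8 ∷ []) ∷ (15 ∷ 17 ∷ 13 ∷ []) ∷ []) ∷
    ((7 ∷ 18 ∷ 0 ∷ []) ∷ (10 ∷ 21 ∷ 3 ∷ []) ∷ (13 ∷ 24 ∷ 6 ∷ []) ∷ (1 ∷ 27 ∷ 9 ∷ []) ∷ (4 ∷ 15 ∷ 12 ∷ []) ∷ (22 ∷ 23 ∷ 2 ∷ []) ∷ (25 ∷ 26 ∷ 5 ∷ []) ∷ (28 ∷ 29 ∷ 8 ∷ []) ∷ (16 ∷ 17 ∷ 11 ∷ []) ∷ (19 ∷ 20 ∷ 14 ∷ []) ∷ []) ∷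
    ((8 ∷ 19 ∷ 1 ∷ []) ∷ (11 ∷ 22 ∷ 4 ∷ []) ∷ (14 ∷ 25 ∷ 7 ∷ []) ∷ (2 ∷ 28 ∷ 10 ∷ []) ∷ (5 ∷ 16 ∷ 13 ∷ []) ∷ (23 ∷ 24 ∷ 3 ∷ []) ∷ (26 ∷ 27 ∷ 6 ∷ []) ∷ (29 ∷ 15 ∷ 9 ∷ []) ∷ (17 ∷ 18 ∷ 12 ∷ []) ∷ (20 ∷ 21 ∷ 0 ∷ []) ∷ []) ∷
    ((9 ∷ 20 ∷ 2 ∷ []) ∷ (12 ∷ 23 ∷ 5 ∷ []) ∷ (0 ∷ 26 ∷ 8 ∷ []) ∷ (3 ∷ 29 ∷ 11 ∷ []) ∷ (6 ∷ 17 ∷ 14 ∷ []) ∷ (24 ∷ 25 ∷ 4 ∷ []) ∷ (27 ∷ 28 ∷ 7 ∷ []) ∷ (15 ∷ 16 ∷ 10 ∷ []) ∷ (18 ∷ 19 ∷ 13 ∷ []) ∷ (21 ∷ 22 ∷ 1 ∷ []) ∷ []) ∷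
    []
  )
  ( ((0 ∷ 3 ∷ 6 ∷ 9 ∷ 12 ∷ []) ∷ (1 ∷ 4 ∷ 7 ∷ 10 ∷ 13 ∷ []) ∷ (2 ∷ 5 ∷ 8 ∷ 11 ∷ 14 ∷ []) ∷ (15 ∷ 21 ∷ 27 ∷ 18 ∷ 24 ∷ []) ∷ (16 ∷ 22 ∷ 28 ∷ 19 ∷ 25 ∷ []) ∷ (17 ∷ 23 ∷ 29 ∷ 20 ∷ 26 ∷ []) ∷ []) ∷
    []
  )

hwp₃₀ 0 _ () _ _
hwp₃₀ 14 _ _ () refl
hwp₃₀ (suc (suc (suc (suc (suc (suc (suc (suc (suc (suc (suc (suc (suc (suc (suc _))))))))))))))) _ _ _ ()

lemma4p4 : (α β : ℕ) → 1 ≤ α → 1 ≤ β → (HWP 30 3 5 α β ⇔ (α + β ≡ 14))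
lemma4p4 α β 1≤α 1≤β = mk⇔ size (hwp₃₀ α β 1≤α 1≤β)
  where
  size : HWP 30 3 5 α β → α + β ≡ 14
  size hwp = ℕ.*-cancelʳ-≡ (α + β) 14 2 (ℕ.suc-injective (ℕ.suc-injective (hwp-size zero refl hwp)))
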